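{- Let $n\ge 4$ and let $\mathbf u=\langle u_0,\ldots,u_{k-1}\rangle$ be a sequence of transpositions in $\mathrm{Sym}(n)$ of length $k\ge 3$ whose transpositional multigraph $\mathcal T(\mathbf u)$ is a multitree on vertex set $n$ having exactly $b$ multiedges of even multiplicity. Suppose: (1) no vertex lies on more than one non-simple multiedge; and (2) each multiedge of even multiplicity is a multitwig whose non-leaf vertex has exactly two neighbors. Then $\mathrm{Prod}(\mathbf u)\subseteq 1^b(n-b)^1$, and therefore $\mathbf u$ is conjugacy invariant.
   Context: $n=\{0,\ldots,n-1\}$; permutations compose left to right. For a finite sequence $\mathbf s$ in $\mathrm{Sym}(n)$, $\bigcirc\mathbf s$ is the composite of its terms in order, $\mathrm{Seq}(\mathbf s)$ its set of rearrangements and $\mathrm{Prod}(\mathbf s)=\{\bigcirc\mathbf r:\mathbf r\in\mathrm{Seq}(\mathbf s)\}$; $\mathbf s$ is conjugacy invariant iff every element of $\mathrm{Prod}(\mathbf s)$ is conjugate to $\bigcirc\mathbf s$. $1^b(n-b)^1$ denotes the conjugacy class of permutations of $n$ having exactly $b$ fixed points and one cycle of length $n-b$. $\mathcal T(\mathbf u)$ is the multigraph on vertex set $n$ in which the multiedge $(x\,y)$ has multiplicity equal to the number of terms of $\mathbf u$ equal to $(x\,y)$; non-simple means multiplicity $\ge2$; neighbors are vertices joined by a multiedge of positive multiplicity. A multitree is a multigraph whose underlying simple graph is a tree. A multitwig is a multiedge $(v\,w)$ of positive multiplicity such that $v$ (its leaf) has exactly one neighbor; $w$ is its non-leaf vertex.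 -}

module Defs where

open import Data.Nat using (ℕ; zero; suc; _+_; _∸_; _≤_; _<_)
open import Data.Nat.Properties using () renaming (_≟_ to _≟ℕ_)
open import Data.Fin using (Fin; _≟_)
import Data.Fin as F
open import Data.Fin.Permutation using (Permutation′; id; flip; _∘ₚ_; transpose; _⟨$⟩ʳ_)
open import Data.List using (List; []; _∷_; foldr; length; filter; allFin; concatMap)
open import Data.List.Relation.Binary.Permutation.Propositional using (_↭_)
open import Data.Product using (Σ; ∃; ∃-syntax; _×_; _,_; proj₁; proj₂)
open import Data.Sum using (_⊎_)
open import Data.Bool using (Bool; true; false; if_then_else_; _∧_; _∨_; not)
open import Relation.Nullary using (¬_; does)
open import Relation.Binary.PropositionalEquality using (_≡_; _≢_)
open import Data.Nat.DivMod using (_%_)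
open import Relation.Nullary.Decidable using (_×-dec_)

record Transp (n : ℕ) : Set where
  constructor tr
  field
    fst : Fin n
    snd : Fin n
    distinct : fst ≢ snd

open Transp public

toPerm : ∀ {n} → Transp n → Permutation′ n
toPerm t = transpose (fst t) (snd t)

-- ○s : composite of the terms in order, composed left to right
-- (∘ₚ is diagrammatic: (σ ∘ₚ τ) applies σ first, then τ).
○ : ∀ {n} → List (Transp n) → Permutation′ n
○ [] = id
○ (t ∷ s) = toPerm t ∘ₚ ○ s

-- r ∈ Seq(s) iff r is a rearrangement of s;
-- σ ∈ Prod(s) iff σ = ○ r (pointwise) for some rearrangement r of s.
_∈Prod_ : ∀ {n} → Permutation′ n → List (Transp n) → Set
σ ∈Prod s = ∃[ r ] (r ↭ s × (∀ x → σ ⟨$⟩ʳ x ≡ ○ r ⟨$⟩ʳ x))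

Conjugate : ∀ {n} → Permutation′ n → Permutation′ n → Set
Conjugate {n} σ ρ = ∃[ τ ] (∀ x → (flip τ ∘ₚ σ ∘ₚ τ) ⟨$⟩ʳ x ≡ ρ ⟨$⟩ʳ x)

ConjugacyInvariant : ∀ {n} → List (Transp n) → Set
ConjugacyInvariant s = ∀ σ → σ ∈Prod s → Conjugate σ (○ s)

numFixed : ∀ {n} → Permutation′ n → ℕ
numFixed {n} σ = length (filter (λ x → σ ⟨$⟩ʳ x ≟ x) (allFin n))

iter : ∀ {n} → Permutation′ n → ℕ → Fin n → Fin n
iter σ zero x = x
iter σ (suc k) x = iter σ k (σ ⟨$⟩ʳ x)

-- σ ∈ 1^b (n-b)^1 : exactly b fixed points and the remaining n-b points
-- form a single cycle (there is a moved point whose orbit contains every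
-- moved point).
InClass1b : ∀ {n} → ℕ → Permutation′ n → Set
InClass1b b σ =
  numFixed σ ≡ b ×
  ∃[ x ] (σ ⟨$⟩ʳ x ≢ x × (∀ y → σ ⟨$⟩ʳ y ≢ y → ∃[ i ] iter σ i x ≡ y))

isEdge : ∀ {n} → Fin n → Fin n → Transp n → Bool
isEdge x y t =
  (does (fst t ≟ x) ∧ does (snd t ≟ y)) ∨ (does (fst t ≟ y) ∧ does (snd t ≟ x))

mult : ∀ {n} → List (Transp n) → Fin n → Fin n → ℕ
mult u x y = length (filter (λ t → isEdge x y t Data.Bool.≟ true) u)

Adj : ∀ {n} → List (Transp n) → Fin n → Fin n → Set
Adj u x y = 0 < mult u x y

data Walk {n} (u : List (Transp n)) : Fin n → Fin n → Set where
  here : ∀ {x} → Walk u x x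
  step : ∀ {x y z} → Adj u x y → Walk u y z → Walk u x z

Connected : ∀ {n} → List (Transp n) → Set
Connected {n} u = ∀ (x y : Fin n) → Walk u x y

record Cycle {n} (u : List (Transp n)) : Set where
  field
    k : ℕ
    v : Fin (3 + k) → Fin n
    inj : ∀ i j → v i ≡ v j → i ≡ j
    adj : ∀ (i : Fin (2 + k)) → Adj u (v (F.inject₁ i)) (v (F.suc i))
    close : Adj u (v (F.fromℕ (2 + k))) (v F.zero)

Acyclic : ∀ {n} → List (Transp n) → Set
Acyclic u = ¬ Cycle u

Multitree : ∀ {n} → List (Transp n) → Set
Multitree u = Connected u × Acyclic u

EvenPos : ℕ → Set
EvenPos k = 0 < k × k % 2 ≡ 0

numEvenEdges : ∀ {n} → List (Transp n) → ℕ
numEvenEdges {n} u =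
  length (filter (λ p → (0 Data.Nat.<? mult u (proj₁ p) (proj₂ p)) ×-dec (mult u (proj₁ p) (proj₂ p) % 2 ≟ℕ 0))
    (concatMap (λ x → concatMap (λ y → if does (F.toℕ x Data.Nat.<? F.toℕ y) then (x , y) ∷ [] else []) (allFin n)) (allFin n)))

NonSimple : ∀ {n} → List (Transp n) → Fin n → Fin n → Set
NonSimple u x y = 2 ≤ mult u x y

Multitwig : ∀ {n} → List (Transp n) → Fin n → Fin n → Set
Multitwig u v w = Adj u v w × (∀ z → Adj u v z → z ≡ w)

ExactlyTwoNeighbors : ∀ {n} → List (Transp n) → Fin n → Set
ExactlyTwoNeighbors u w =
  ∃[ z₁ ] ∃[ z₂ ] (z₁ ≢ z₂ × Adj u w z₁ × Adj u w z₂ × (∀ z → Adj u w z → z ≡ z₁ ⊎ z ≡ z₂))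

module Submission where

-- Moving the nonsimple terms of r to the end,
-- conjugating the simple terms they pass, keeps the product (Sort). By (1)
-- the nonsimple edges form a matching, so the nonsimple part only counts
-- modulo 2 (Matching). The resulting normal form is separated: each term
-- joins two components of the graph of the later terms, or T(u) would
-- have a cycle (edge-is-bridge); and the product of a separated word is
-- one cycle on each component of its graph (separated⇒cycles). By (2)
-- exactly one end of each even multiedge is fixed and the remaining points
-- form one component (Analysis); counting gives b (Counting). Permutations
-- with one cycle of the same length are conjugate (one-cycle-conjugate).

open import Defs
open import Data.Nat using (ℕ; _≤_; _<_)
open import Data.Fin using (Fin)
open import Data.List using (List; length)
open import Data.Product using (_×_)
open import Data.Sum using (_⊎_)
open import Relation.Binary.PropositionalEquality using (_≡_)
open import Data.Fin.Permutation using (Permutation′)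

open import Data.Nat using (zero; suc; _+_; _∸_; _%_; _<?_; _≤?_; z≤n; s≤s)
import Data.Nat.Properties as ℕₚ
open import Data.Nat.DivMod using (m%n<n; m%n%n≡m%n)
open import Data.Fin using (toℕ)
import Data.Fin as F
open import Data.Fin.Properties using (_≟_; any?; suc-injective; toℕ-injective)
open import Data.Fin.Permutation using (_⟨$⟩ʳ_; _⟨$⟩ˡ_; transpose; _∘ₚ_; flip; id; inverseˡ; inverseʳ)
import Data.Fin.Permutation.Components as PC
open import Data.Bool using (true; false; if_then_else_)
open import Data.Bool.Properties using (∨-zeroʳ) renaming (_≟_ to _≟ᵇ_)
open import Data.List using ([]; _∷_; _++_; [_]; filter; map; concatMap; allFin)
open import Data.List.Properties using (++-assoc; map-∘; length-map; length-tabulate)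
open import Data.List.Relation.Unary.Any as Any using (Any; here; there)
import Data.List.Relation.Unary.Any.Properties as Anyₚ
open import Data.List.Relation.Unary.All as All using (All; []; _∷_)
import Data.List.Relation.Unary.All.Properties as Allₚ
import Data.List.Relation.Unary.AllPairs as AllPairs
open import Data.List.Relation.Unary.AllPairs using ([]; _∷_)
import Data.List.Relation.Unary.AllPairs.Properties as AllPairsₚ
open import Data.List.Membership.Propositional using (_∈_; _∉_; find; lose)
open import Data.List.Membership.Propositional.Properties
  using (∈-++⁺ˡ; ∈-++⁺ʳ; ∈-++⁻; ∈-∃++; ∈-filter⁺; ∈-filter⁻; ∈-allFin; ∈-map⁺; ∈-map⁻;
         ∈-concatMap⁺; ∈-concatMap⁻)
open import Data.List.Membership.Propositional.Properties.WithK using (unique∧set⇒bag)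
open import Data.List.Relation.Unary.Unique.Propositional using (Unique)
import Data.List.Relation.Unary.Unique.Propositional.Properties as Unique
open import Data.List.Relation.Binary.Disjoint.Propositional using (Disjoint)
open import Data.List.Relation.Binary.BagAndSetEquality using (∼bag⇒↭)
open import Data.List.Relation.Binary.Permutation.Propositional using (_↭_; ↭-refl; ↭-sym; ↭-trans; ↭-reflexive; ↭⇒↭ₛ)
open import Data.List.Relation.Binary.Permutation.Propositional.Properties using (filter-↭; ↭-length; ∈-resp-↭; ++-comm)
import Data.List.Relation.Binary.Permutation.Setoid.Properties as Permutationₛ
open import Data.Product using (Σ; ∃; ∃-syntax; _,_; proj₁; proj₂)
open import Data.Sum as Sum using (inj₁; inj₂)
open import Data.Unit using (⊤)
open import Data.Empty using (⊥; ⊥-elim)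
open import Function.Bundles using (mk⇔)
open import Relation.Nullary using (¬_; Dec; yes; no; does; ¬?; contradiction)
open import Relation.Nullary.Decidable using (dec-true; dec-false; decidable-stable; _×-dec_; _⊎-dec_)
open import Relation.Unary using (Decidable)
open import Relation.Binary.Definitions using (tri<; tri≈; tri>)
open import Relation.Binary.Construct.Closure.ReflexiveTransitive as Star using (Star; ε; _◅_; _◅◅_; _>>=_)
open import Relation.Binary.PropositionalEquality using (_≢_; refl; sym; trans; cong; cong₂; subst; setoid; module ≡-Reasoning)

module _ {n : ℕ} where

  swap : Fin n → Fin n → Fin n → Fin n
  swap = PC.transpose

  swap-fst : ∀ a b → swap a b a ≡ b
  swap-fst a b rewrite dec-true (a ≟ a) refl = refl

  swap-snd : ∀ a b → swap a b b ≡ a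
  swap-snd a b with b ≟ a
  ... | yes b≡a = b≡a
  ... | no b≢a rewrite dec-true (b ≟ b) refl = refl

  swap-other : ∀ {a b x} → x ≢ a → x ≢ b → swap a b x ≡ x
  swap-other {a} {b} {x} x≢a x≢b rewrite dec-false (x ≟ a) x≢a | dec-false (x ≟ b) x≢b = refl

  data SwapView (a b x : Fin n) : Set where
    is-fst : x ≡ a → SwapView a b x
    is-snd : x ≢ a → x ≡ b → SwapView a b x
    is-other : x ≢ a → x ≢ b → SwapView a b x

  swapView : ∀ a b x → SwapView a b x
  swapView a b x with x ≟ a | x ≟ b
  ... | yes x≡a | _ = is-fst x≡a
  ... | no x≢a | yes x≡b = is-snd x≢a x≡b
  ... | no x≢a | no x≢b = is-other x≢a x≢b

  swap-comm : ∀ a b x → swap a b x ≡ swap b a x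
  swap-comm a b x with swapView a b x
  ... | is-fst refl rewrite swap-fst a b = sym (swap-snd b a)
  ... | is-snd _ refl rewrite swap-snd a b = sym (swap-fst b a)
  ... | is-other x≢a x≢b rewrite swap-other x≢a x≢b = sym (swap-other x≢b x≢a)

  swap-involutive : ∀ a b x → swap a b (swap a b x) ≡ x
  swap-involutive a b x = trans (cong (swap a b) (swap-comm a b x)) (PC.transpose-inverse a b)

  swap-injective : ∀ a b {x y} → swap a b x ≡ swap a b y → x ≡ y
  swap-injective a b {x} {y} e =
    trans (sym (swap-involutive a b x)) (trans (cong (swap a b) e) (swap-involutive a b y))

  swap-relabel : (f : Fin n → Fin n) → (∀ {x y} → f x ≡ f y → x ≡ y) →
                 ∀ a b y → swap (f a) (f b) (f y) ≡ f (swap a b y)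
  swap-relabel f f-inj a b y with swapView a b y
  ... | is-fst refl rewrite swap-fst a b = swap-fst (f a) (f b)
  ... | is-snd _ refl rewrite swap-snd a b = swap-snd (f a) (f b)
  ... | is-other y≢a y≢b rewrite swap-other y≢a y≢b =
    swap-other (λ e → y≢a (f-inj e)) (λ e → y≢b (f-inj e))

  apply : Transp n → Fin n → Fin n
  apply t = swap (fst t) (snd t)

  applyWord : List (Transp n) → Fin n → Fin n
  applyWord [] x = x
  applyWord (t ∷ s) x = applyWord s (apply t x)

  applyWord-++ : ∀ s s′ x → applyWord (s ++ s′) x ≡ applyWord s′ (applyWord s x)
  applyWord-++ [] s′ x = refl
  applyWord-++ (t ∷ s) s′ x = applyWord-++ s s′ (apply t x)

  ○-applyWord : ∀ (s : List (Transp n)) x → ○ s ⟨$⟩ʳ x ≡ applyWord s x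
  ○-applyWord [] x = refl
  ○-applyWord (t ∷ s) x = ○-applyWord s (apply t x)

  SameEdge : Fin n → Fin n → Fin n → Fin n → Set
  SameEdge a b x y = (a ≡ x × b ≡ y) ⊎ (a ≡ y × b ≡ x)

  SameEdge-swapʳ : ∀ {a b x y} → SameEdge a b x y → SameEdge a b y x
  SameEdge-swapʳ (inj₁ (p , q)) = inj₂ (p , q)
  SameEdge-swapʳ (inj₂ (p , q)) = inj₁ (p , q)

  SameEdge-swapˡ : ∀ {a b x y} → SameEdge a b x y → SameEdge b a x y
  SameEdge-swapˡ (inj₁ (p , q)) = inj₂ (q , p)
  SameEdge-swapˡ (inj₂ (p , q)) = inj₁ (q , p)

  SameEdge-sym : ∀ {a b x y} → SameEdge a b x y → SameEdge x y a b
  SameEdge-sym (inj₁ (p , q)) = inj₁ (sym p , sym q)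
  SameEdge-sym (inj₂ (p , q)) = inj₂ (sym q , sym p)

  SameEdge-trans : ∀ {a b c d x y} → SameEdge a b c d → SameEdge c d x y → SameEdge a b x y
  SameEdge-trans (inj₁ (refl , refl)) q = q
  SameEdge-trans (inj₂ (refl , refl)) q = SameEdge-swapˡ q

  data OnEdge (t : Transp n) (x y : Fin n) : Set where
    forward : fst t ≡ x → snd t ≡ y → OnEdge t x y
    backward : fst t ≡ y → snd t ≡ x → OnEdge t x y

  onEdge? : ∀ t x y → Dec (OnEdge t x y)
  onEdge? t x y with fst t ≟ x | snd t ≟ y | fst t ≟ y | snd t ≟ x
  ... | yes p | yes q | _     | _     = yes (forward p q)
  ... | _     | _     | yes p | yes q = yes (backward p q)
  ... | yes _ | no q  | no p′ | _     = no λ { (forward _ e) → q e ; (backward e _) → p′ e }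
  ... | yes _ | no q  | yes _ | no q′ = no λ { (forward _ e) → q e ; (backward _ e) → q′ e }
  ... | no p  | _     | no p′ | _     = no λ { (forward e _) → p e ; (backward e _) → p′ e }
  ... | no p  | _     | yes _ | no q′ = no λ { (forward e _) → p e ; (backward _ e) → q′ e }

  onEdge-refl : ∀ t → OnEdge t (fst t) (snd t)
  onEdge-refl t = forward refl refl

  OnEdge-flip : ∀ {t x y} → OnEdge t x y → OnEdge t y x
  OnEdge-flip (forward p q) = backward p q
  OnEdge-flip (backward p q) = forward p q

  OnEdge⇒SameEdge : ∀ {t x y} → OnEdge t x y → SameEdge (fst t) (snd t) x y
  OnEdge⇒SameEdge (forward p q) = inj₁ (p , q)
  OnEdge⇒SameEdge (backward p q) = inj₂ (p , q)

  OnEdge-SameEdge : ∀ {t a b x y} → OnEdge t a b → SameEdge a b x y → OnEdge t x y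
  OnEdge-SameEdge on (inj₁ (refl , refl)) = on
  OnEdge-SameEdge on (inj₂ (refl , refl)) = OnEdge-flip on

  onEdge⇒isEdge : ∀ {t x y} → OnEdge t x y → isEdge x y t ≡ true
  onEdge⇒isEdge {t} (forward refl refl)
    rewrite dec-true (fst t ≟ fst t) refl | dec-true (snd t ≟ snd t) refl = refl
  onEdge⇒isEdge {t} (backward refl refl)
    rewrite dec-true (fst t ≟ fst t) refl | dec-true (snd t ≟ snd t) refl = ∨-zeroʳ _

  isEdge⇒onEdge : ∀ {t x y} → isEdge x y t ≡ true → OnEdge t x y
  isEdge⇒onEdge {t} {x} {y} e with fst t ≟ x | snd t ≟ y | fst t ≟ y | snd t ≟ x
  ... | yes p | yes q | _     | _     = forward p q
  ... | _     | _     | yes p | yes q = backward p q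
  ... | yes _ | no _  | no _  | _     = contradiction e λ ()
  ... | yes _ | no _  | yes _ | no _  = contradiction e λ ()
  ... | no _  | _     | no _  | _     = contradiction e λ ()
  ... | no _  | _     | yes _ | no _  = contradiction e λ ()

  mult-on : ∀ {t x y} L → OnEdge t x y → mult (t ∷ L) x y ≡ suc (mult L x y)
  mult-on L on rewrite onEdge⇒isEdge on = refl

  mult-off : ∀ {t x y} L → ¬ OnEdge t x y → mult (t ∷ L) x y ≡ mult L x y
  mult-off {t} {x} {y} L off with isEdge x y t in e
  ... | true = ⊥-elim (off (isEdge⇒onEdge e))
  ... | false = refl

  mult-∷-≤ : ∀ t L x y → mult L x y ≤ mult (t ∷ L) x y
  mult-∷-≤ t L x y with onEdge? t x y
  ... | yes on = subst (mult L x y ≤_) (sym (mult-on L on)) (ℕₚ.n≤1+n _)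
  ... | no off = ℕₚ.≤-reflexive (sym (mult-off L off))

  mult-sym : ∀ L x y → mult L x y ≡ mult L y x
  mult-sym [] x y = refl
  mult-sym (t ∷ L) x y with onEdge? t x y
  ... | yes on = trans (mult-on L on) (trans (cong suc (mult-sym L x y)) (sym (mult-on L (OnEdge-flip on))))
  ... | no off = trans (mult-off L off) (trans (mult-sym L x y) (sym (mult-off L (λ on → off (OnEdge-flip on)))))

  mult-SameEdge : ∀ L {a b x y} → SameEdge a b x y → mult L a b ≡ mult L x y
  mult-SameEdge L (inj₁ (refl , refl)) = refl
  mult-SameEdge L {a} {b} (inj₂ (refl , refl)) = mult-sym L a b

  mult-↭ : ∀ {L M : List (Transp n)} → L ↭ M → ∀ x y → mult L x y ≡ mult M x y
  mult-↭ p x y = ↭-length (filter-↭ (λ t → isEdge x y t ≟ᵇ true) p)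

  Carries : List (Transp n) → Fin n → Fin n → Set
  Carries L x y = Any (λ t → OnEdge t x y) L

  Carries-sym : ∀ {L x y} → Carries L x y → Carries L y x
  Carries-sym = Any.map OnEdge-flip

  mult-pos⇒Carries : ∀ L {x y} → 0 < mult L x y → Carries L x y
  mult-pos⇒Carries (t ∷ L) {x} {y} pos with onEdge? t x y
  ... | yes on = here on
  ... | no off = there (mult-pos⇒Carries L (subst (0 <_) (mult-off L off) pos))

  Carries⇒mult-pos : ∀ L {x y} → Carries L x y → 0 < mult L x y
  Carries⇒mult-pos (t ∷ L) (here on) = subst (0 <_) (sym (mult-on L on)) (s≤s z≤n)
  Carries⇒mult-pos (t ∷ L) {x} {y} (there c) = ℕₚ.≤-trans (Carries⇒mult-pos L c) (mult-∷-≤ t L x y)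

  Reach : List (Transp n) → Fin n → Fin n → Set
  Reach L = Star (Carries L)

  Reach-sym : ∀ {L x y} → Reach L x y → Reach L y x
  Reach-sym = Star.reverse Carries-sym

  Walk⇒Reach : ∀ {L x y} → Walk L x y → Reach L x y
  Walk⇒Reach here = ε
  Walk⇒Reach {L} (step adj w) = mult-pos⇒Carries L adj ◅ Walk⇒Reach w

module _ {n : ℕ} where

  data Touches (t : Transp n) (x : Fin n) : Set where
    at-fst : fst t ≡ x → Touches t x
    at-snd : snd t ≡ x → Touches t x

  touches? : ∀ t x → Dec (Touches t x)
  touches? t x with fst t ≟ x | snd t ≟ x
  ... | yes p | _ = yes (at-fst p)
  ... | no _ | yes q = yes (at-snd q)
  ... | no p | no q = no λ { (at-fst e) → p e ; (at-snd e) → q e }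

  apply-on : ∀ {t : Transp n} {x y} → OnEdge t x y → apply t x ≡ y
  apply-on {t} (forward refl refl) = swap-fst (fst t) (snd t)
  apply-on {t} (backward refl refl) = swap-snd (fst t) (snd t)

  apply-untouched : ∀ {t : Transp n} {x} → ¬ Touches t x → apply t x ≡ x
  apply-untouched t∌x = swap-other (λ e → t∌x (at-fst (sym e))) (λ e → t∌x (at-snd (sym e)))

  untouched-off : ∀ {t : Transp n} {x y} → ¬ Touches t x → ¬ OnEdge t x y
  untouched-off t∌x (forward p _) = t∌x (at-fst p)
  untouched-off t∌x (backward _ q) = t∌x (at-snd q)

  Touched : List (Transp n) → Fin n → Set
  Touched L z = Any (λ t → Touches t z) L

  touched? : ∀ L z → Dec (Touched L z)
  touched? L z = Any.any? (λ t → touches? t z) L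

  Carries⇒Touched : ∀ {L x y} → Carries L x y → Touched L x
  Carries⇒Touched = Any.map λ { (forward p _) → at-fst p ; (backward _ q) → at-snd q }

  touched-neighbour : ∀ {L z} → Touched L z → ∃ λ w → Carries L z w × w ≢ z
  touched-neighbour Lz with find Lz
  ... | (t , t∈ , at-fst p) = snd t , lose t∈ (forward p refl) , λ e → distinct t (trans p (sym e))
  ... | (t , t∈ , at-snd p) = fst t , lose t∈ (backward refl p) , λ e → distinct t (trans e (sym p))

  applyWord-untouched : ∀ L {z} → ¬ Touched L z → applyWord L z ≡ z
  applyWord-untouched [] _ = refl
  applyWord-untouched (t ∷ L) L∌z =
    trans (cong (applyWord L) (apply-untouched (λ tz → L∌z (here tz)))) (applyWord-untouched L (λ Lz → L∌z (there Lz)))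

  mult-irreflexive : ∀ L (x : Fin n) → mult L x x ≡ 0
  mult-irreflexive [] x = refl
  mult-irreflexive (t ∷ L) x = trans (mult-off L loop) (mult-irreflexive L x)
    where
    loop : ¬ OnEdge t x x
    loop (forward p q) = distinct t (trans p (sym q))
    loop (backward p q) = distinct t (trans p (sym q))

module _ {A : Set} where

  count : ∀ {P : A → Set} → Decidable P → List A → ℕ
  count P? xs = length (filter P? xs)

  count-mono : ∀ {P Q : A → Set} (P? : Decidable P) (Q? : Decidable Q) xs →
               (∀ {x} → x ∈ xs → P x → Q x) → count P? xs ≤ count Q? xs
  count-mono P? Q? [] _ = z≤n
  count-mono P? Q? (x ∷ xs) P⇒Q with P? x | Q? x
  ... | yes p | yes _ = s≤s (count-mono P? Q? xs (λ x∈ → P⇒Q (there x∈)))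
  ... | yes p | no ¬q = ⊥-elim (¬q (P⇒Q (here refl) p))
  ... | no _ | yes _ = ℕₚ.m≤n⇒m≤1+n (count-mono P? Q? xs (λ x∈ → P⇒Q (there x∈)))
  ... | no _ | no _ = count-mono P? Q? xs (λ x∈ → P⇒Q (there x∈))

  count-cong : ∀ {P Q : A → Set} (P? : Decidable P) (Q? : Decidable Q) xs →
               (∀ x → (P x → Q x) × (Q x → P x)) → count P? xs ≡ count Q? xs
  count-cong P? Q? xs P⇔Q =
    ℕₚ.≤-antisym (count-mono P? Q? xs (λ _ → proj₁ (P⇔Q _))) (count-mono Q? P? xs (λ _ → proj₂ (P⇔Q _)))

  count-complement : ∀ {P : A → Set} (P? : Decidable P) xs → count P? xs + count (λ x → ¬? (P? x)) xs ≡ length xs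
  count-complement P? [] = refl
  count-complement P? (x ∷ xs) with P? x
  ... | yes _ = cong suc (count-complement P? xs)
  ... | no _ = trans (ℕₚ.+-suc _ _) (cong suc (count-complement P? xs))

  count-≤1 : ∀ {P : A → Set} (P? : Decidable P) xs → count P? xs ≤ 1 →
             ∀ {x y} → x ∈ xs → y ∈ xs → P x → P y → x ≡ y
  count-≤1 P? xs ≤1 x∈ y∈ px py = at-most-one (filter P? xs) ≤1 (∈-filter⁺ P? x∈ px) (∈-filter⁺ P? y∈ py)
    where
    at-most-one : ∀ zs → length zs ≤ 1 → ∀ {x y} → x ∈ zs → y ∈ zs → x ≡ y
    at-most-one (z ∷ []) _ (here refl) (here refl) = refl
    at-most-one (_ ∷ _ ∷ _) (s≤s ())

  same-elements⇒same-length : ∀ {xs ys : List A} → Unique xs → Unique ys →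
    (∀ {x} → x ∈ xs → x ∈ ys) → (∀ {x} → x ∈ ys → x ∈ xs) → length xs ≡ length ys
  same-elements⇒same-length ux uy to from = ↭-length (∼bag⇒↭ (unique∧set⇒bag ux uy (mk⇔ to from)))

module _ {A B : Set} where

  map-unique : (f : A → B) (xs : List A) → Unique xs →
               (∀ {a b} → a ∈ xs → b ∈ xs → f a ≡ f b → a ≡ b) → Unique (map f xs)
  map-unique f [] _ _ = AllPairs.[]
  map-unique f (x ∷ xs) (x∉ AllPairs.∷ u) inj =
    All.tabulate (λ z∈ e → let (w , w∈ , z≡) = ∈-map⁻ f z∈ in
                              All.lookup x∉ w∈ (inj (here refl) (there w∈) (trans e z≡)))
    AllPairs.∷ map-unique f xs u (λ a∈ b∈ → inj (there a∈) (there b∈))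

  concatMap-unique : (f : A → List B) (xs : List A) → Unique xs → (∀ x → Unique (f x)) →
                     (key : B → A) → (∀ {x z} → z ∈ f x → key z ≡ x) → Unique (concatMap f xs)
  concatMap-unique f xs uxs uf key key-f =
    Unique.concat⁺ (Allₚ.map⁺ (All.tabulate (λ {x} _ → uf x)))
      (AllPairsₚ.map⁺ {f = f}
        (AllPairs.map (λ x≢y {_} (z∈fx , z∈fy) → x≢y (trans (sym (key-f z∈fx)) (key-f z∈fy))) uxs))

module _ {n : ℕ} {R : Fin n → Fin n → Set} where

  data Path : Fin n → Fin n → ℕ → Set where
    [] : ∀ {x} → Path x x 0
    _∷_ : ∀ {x y z m} → R x y → Path y z m → Path x z (suc m)

  vertex : ∀ {x z m} → Path x z m → Fin (suc m) → Fin n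
  vertex {x = x} p F.zero = x
  vertex (r ∷ p) (F.suc i) = vertex p i

  vertex-last : ∀ {x z m} (p : Path x z m) → vertex p (F.fromℕ m) ≡ z
  vertex-last [] = refl
  vertex-last (r ∷ p) = vertex-last p

  vertex-step : ∀ {x z m} (p : Path x z m) (i : Fin m) → R (vertex p (F.inject₁ i)) (vertex p (F.suc i))
  vertex-step (r ∷ []) F.zero = r
  vertex-step (r ∷ (_ ∷ _)) F.zero = r
  vertex-step (r ∷ p) (F.suc i) = vertex-step p i

  first-step : ∀ {x y} → Star R x y → y ≢ x → ∃ λ w → R x w
  first-step ε y≢x = ⊥-elim (y≢x refl)
  first-step (c ◅ _) _ = _ , c

  record SimplePath (x z : Fin n) : Set where
    field
      steps : ℕ
      path : Path x z steps
      simple : ∀ i j → vertex path i ≡ vertex path j → i ≡ j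

  record Tail {x z m} (p : Path x z m) (y : Fin n) : Set where
    field
      steps : ℕ
      path : Path y z steps
      index : Fin (suc steps) → Fin (suc m)
      vertex-index : ∀ i → vertex path i ≡ vertex p (index i)
      index-injective : ∀ i j → index i ≡ index j → i ≡ j

  tail : ∀ {x z m} (p : Path x z m) (j : Fin (suc m)) → Tail p (vertex p j)
  tail p F.zero = record
    { path = p ; index = λ i → i ; vertex-index = λ i → refl ; index-injective = λ i j e → e }
  tail (r ∷ p) (F.suc j) = record
    { path = Tail.path t ; index = λ i → F.suc (Tail.index t i)
    ; vertex-index = Tail.vertex-index t
    ; index-injective = λ i i′ e → Tail.index-injective t i i′ (suc-injective e) }
    where t = tail p j

  -- Every walk can be shortened to a simple path: when the next vertex
  -- reappears later, jump to its last occurrence.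
  shorten : ∀ {x z} → Star R x z → SimplePath x z
  shorten ε = record { path = [] ; simple = λ { F.zero F.zero _ → refl } }
  shorten {x} (r ◅ w) with shorten w
  ... | record { path = p ; simple = simple } with any? (λ j → vertex p j ≟ x)
  ... | yes (j , refl) = record
    { path = Tail.path t
    ; simple = λ i i′ e → Tail.index-injective t i i′
        (simple _ _ (trans (sym (Tail.vertex-index t i)) (trans e (Tail.vertex-index t i′)))) }
    where t = tail p j
  ... | no x∉p = record { path = r ∷ p ; simple = simple′ }
    where
    simple′ : ∀ i j → vertex (r ∷ p) i ≡ vertex (r ∷ p) j → i ≡ j
    simple′ F.zero F.zero e = refl
    simple′ F.zero (F.suc j) e = ⊥-elim (x∉p (j , sym e))
    simple′ (F.suc i) F.zero e = ⊥-elim (x∉p (i , e))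
    simple′ (F.suc i) (F.suc j) e = cong F.suc (simple i j e)

module _ {n : ℕ} where

  Avoiding : List (Transp n) → Fin n → Fin n → Fin n → Fin n → Set
  Avoiding u a b x y = Carries u x y × ¬ SameEdge a b x y

  Avoiding-sym : ∀ {u a b x y} → Avoiding u a b x y → Avoiding u a b y x
  Avoiding-sym (c , ¬same) = Carries-sym c , λ same → ¬same (SameEdge-swapʳ same)

  bypass⇒cycle : ∀ {u : List (Transp n)} {a b} → a ≢ b → Carries u a b →
                 Star (Avoiding u a b) a b → Cycle u
  bypass⇒cycle {u} {a} {b} a≢b ab w with shorten w
  ... | record { steps = zero ; path = [] } = ⊥-elim (a≢b refl)
  ... | record { steps = suc zero ; path = r ∷ [] } = ⊥-elim (proj₂ r (inj₁ (refl , refl)))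
  ... | record { steps = suc (suc k) ; path = p ; simple = simple } = record
    { k = k
    ; v = vertex p
    ; inj = simple
    ; adj = λ i → Carries⇒mult-pos u (proj₁ (vertex-step p i))
    ; close = subst (λ v → Adj u v a) (sym (vertex-last p)) (Carries⇒mult-pos u (Carries-sym ab)) }

  edge-is-bridge : ∀ {u : List (Transp n)} {a b} → Acyclic u → a ≢ b → Carries u a b →
                   ¬ Star (Avoiding u a b) a b
  edge-is-bridge acyclic a≢b ab w = acyclic (bypass⇒cycle a≢b ab w)

module _ {n : ℕ} where

  -- relabel P applies the terms of P from right to left; it is the map by
  -- which the word P conjugates transpositions.
  relabel : List (Transp n) → Fin n → Fin n
  relabel [] z = z
  relabel (p ∷ P) z = apply p (relabel P z)

  relabel-injective : ∀ P {x y} → relabel P x ≡ relabel P y → x ≡ y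
  relabel-injective [] e = e
  relabel-injective (p ∷ P) e = relabel-injective P (swap-injective (fst p) (snd p) e)

  conjugateBy : List (Transp n) → Transp n → Transp n
  conjugateBy P t = tr (relabel P (fst t)) (relabel P (snd t))
                       (λ e → distinct t (relabel-injective P e))

  conjugate-touches : ∀ Q {s x y} → OnEdge s x y → Touches (conjugateBy Q s) (relabel Q x)
  conjugate-touches Q (forward refl _) = at-fst refl
  conjugate-touches Q (backward _ refl) = at-snd refl

  push-past : ∀ t P x → apply t (applyWord P x) ≡ applyWord P (apply (conjugateBy P t) x)
  push-past t [] x = refl
  push-past t (p ∷ P) x = trans (push-past t P (apply p x)) (cong (applyWord P) commute)
    where
    a = relabel P (fst t)
    b = relabel P (snd t)
    f = apply p
    f-involutive : ∀ y → f (f y) ≡ y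
    f-involutive = swap-involutive (fst p) (snd p)
    commute : swap a b (f x) ≡ f (swap (f a) (f b) x)
    commute = begin
      swap a b (f x)                ≡⟨ sym (f-involutive _) ⟩
      f (f (swap a b (f x)))        ≡⟨ cong f (sym (swap-relabel f (swap-injective (fst p) (snd p)) a b (f x))) ⟩
      f (swap (f a) (f b) (f (f x))) ≡⟨ cong (λ y → f (swap (f a) (f b) y)) (f-involutive x) ⟩
      f (swap (f a) (f b) x)        ∎
      where open ≡-Reasoning

-- Sorting a word so that the terms satisfying Keep come last, in their
-- original order; every other term is conjugated by the kept terms it has
-- been moved past.
module Sort {n : ℕ} {Keep : Transp n → Set} (keep? : ∀ t → Dec (Keep t)) where

  kept : List (Transp n) → List (Transp n)
  kept [] = []
  kept (t ∷ q) with keep? t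
  ... | yes _ = t ∷ kept q
  ... | no _ = kept q

  moved : List (Transp n) → List (Transp n) → List (Transp n)
  moved P [] = []
  moved P (t ∷ q) with keep? t
  ... | yes _ = moved (P ++ [ t ]) q
  ... | no _ = conjugateBy P t ∷ moved P q

  sort-word : ∀ P q x → applyWord (P ++ q) x ≡ applyWord (moved P q ++ P ++ kept q) x
  sort-word P [] x = refl
  sort-word P (t ∷ q) x with keep? t
  ... | yes _ = begin
    applyWord (P ++ t ∷ q) x                       ≡⟨ cong (λ l → applyWord l x) (sym (++-assoc P [ t ] q)) ⟩
    applyWord ((P ++ [ t ]) ++ q) x                ≡⟨ sort-word (P ++ [ t ]) q x ⟩
    applyWord (moved (P ++ [ t ]) q ++ (P ++ [ t ]) ++ kept q) x
      ≡⟨ cong (λ l → applyWord (moved (P ++ [ t ]) q ++ l) x) (++-assoc P [ t ] (kept q)) ⟩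
    applyWord (moved (P ++ [ t ]) q ++ P ++ t ∷ kept q) x ∎
    where open ≡-Reasoning
  ... | no _ = begin
    applyWord (P ++ t ∷ q) x                          ≡⟨ applyWord-++ P (t ∷ q) x ⟩
    applyWord q (apply t (applyWord P x))             ≡⟨ cong (applyWord q) (push-past t P x) ⟩
    applyWord q (applyWord P (apply (conjugateBy P t) x)) ≡⟨ sym (applyWord-++ P q _) ⟩
    applyWord (P ++ q) (apply (conjugateBy P t) x)    ≡⟨ sort-word P q _ ⟩
    applyWord (moved P q ++ P ++ kept q) (apply (conjugateBy P t) x) ∎
    where open ≡-Reasoning

  sort : ∀ r x → applyWord r x ≡ applyWord (kept r) (applyWord (moved [] r) x)
  sort r x = trans (sort-word [] r x) (applyWord-++ (moved [] r) (kept r) x)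

  mult-kept : ∀ q {x y} → (∀ {t} → OnEdge t x y → Keep t) → mult (kept q) x y ≡ mult q x y
  mult-kept [] _ = refl
  mult-kept (t ∷ q) {x} {y} keeps with keep? t | onEdge? t x y
  ... | yes _ | yes on = trans (mult-on (kept q) on) (trans (cong suc (mult-kept q keeps)) (sym (mult-on q on)))
  ... | yes _ | no off = trans (mult-off (kept q) off) (trans (mult-kept q keeps) (sym (mult-off q off)))
  ... | no ¬k | yes on = ⊥-elim (¬k (keeps on))
  ... | no _ | no off = trans (mult-kept q keeps) (sym (mult-off q off))

  kept-Keep : ∀ q → All Keep (kept q)
  kept-Keep [] = []
  kept-Keep (t ∷ q) with keep? t
  ... | yes k = k ∷ kept-Keep q
  ... | no _ = kept-Keep q

  record Origin (q : List (Transp n)) (g : Transp n) : Set where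
    constructor origin
    field
      {Q} : List (Transp n)
      {s} : Transp n
      Q-kept : All Keep Q
      s∈q : s ∈ q
      s-moved : ¬ Keep s
      g≡ : g ≡ conjugateBy Q s

  origin-there : ∀ {t q g} → Origin q g → Origin (t ∷ q) g
  origin-there (origin Q-kept s∈q s-moved g≡) = origin Q-kept (there s∈q) s-moved g≡

  origin-of : ∀ P q {g} → All Keep P → g ∈ moved P q → Origin q g
  origin-of P (t ∷ q) P-kept g∈ with keep? t
  ... | yes k = origin-there (origin-of (P ++ [ t ]) q (Allₚ.++⁺ P-kept (k ∷ [])) g∈)
  ... | no ¬k with g∈
  ...   | here refl = origin P-kept (here refl) ¬k refl
  ...   | there g∈′ = origin-there (origin-of P q P-kept g∈′)

  moved-of : ∀ P q {s} → All Keep P → s ∈ q → ¬ Keep s →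
             ∃ λ Q → All Keep Q × conjugateBy Q s ∈ moved P q
  moved-of P (t ∷ q) P-kept s∈ ¬ks with keep? t | s∈
  ... | yes k | here refl = ⊥-elim (¬ks k)
  ... | yes k | there s∈′ = moved-of (P ++ [ t ]) q (Allₚ.++⁺ P-kept (k ∷ [])) s∈′ ¬ks
  ... | no _ | here refl = P , P-kept , here refl
  ... | no _ | there s∈′ = let (Q , Q-kept , m) = moved-of P q P-kept s∈′ ¬ks in Q , Q-kept , there m

  count-moved : ∀ {Z : Transp n → Set} (Z? : ∀ t → Dec (Z t)) →
                (∀ {Q t} → All Keep Q → (Z t → Z (conjugateBy Q t)) × (Z (conjugateBy Q t) → Z t)) →
                ∀ P q → All Keep P → count Z? (moved P q) ≡ count (λ t → ¬? (keep? t) ×-dec Z? t) q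
  count-moved Z? invariant P [] _ = refl
  count-moved Z? invariant P (t ∷ q) P-kept with keep? t
  ... | yes k = count-moved Z? invariant (P ++ [ t ]) q (Allₚ.++⁺ P-kept (k ∷ []))
  ... | no ¬k with Z? (conjugateBy P t) | Z? t
  ...   | yes _ | yes _ = cong suc (count-moved Z? invariant P q P-kept)
  ...   | yes z | no ¬z = ⊥-elim (¬z (proj₂ (invariant P-kept) z))
  ...   | no ¬z | yes z = ⊥-elim (¬z (proj₁ (invariant P-kept) z))
  ...   | no _ | no _ = count-moved Z? invariant P q P-kept

module _ {n : ℕ} where

  open import Data.List.Membership.DecPropositional (_≟_ {n}) using (_∈?_)

  data Trace (σ : Fin n → Fin n) : Fin n → List (Fin n) → Fin n → Set where
    end : ∀ {x} → Trace σ x [] x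
    next : ∀ {x y ys z} → σ x ≡ y → Trace σ y ys z → Trace σ x (y ∷ ys) z

  trace-++ : ∀ {σ x ys y zs z} → Trace σ x ys y → Trace σ y zs z → Trace σ x (ys ++ zs) z
  trace-++ end q = q
  trace-++ (next e p) q = next e (trace-++ p q)

  trace-split : ∀ {σ a z} (p : List (Fin n)) (x : Fin n) (s : List (Fin n)) →
                Trace σ a (p ++ x ∷ s) z → Trace σ a (p ++ [ x ]) x × Trace σ x s z
  trace-split [] x s (next e q) = next e end , q
  trace-split (y ∷ p) x s (next e q) = let (q₁ , q₂) = trace-split p x s q in next e q₁ , q₂

  trace-last∈ : ∀ {σ x y ys z} → Trace σ x (y ∷ ys) z → z ∈ y ∷ ys
  trace-last∈ (next e end) = here refl
  trace-last∈ (next e (next e′ p)) = there (trace-last∈ (next e′ p))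

  trace-cong : ∀ {σ σ′ x ys z} → (∀ w → σ′ w ≡ σ w) → Trace σ x ys z → Trace σ′ x ys z
  trace-cong σ′≗σ end = end
  trace-cong σ′≗σ (next e p) = next (trans (σ′≗σ _) e) (trace-cong σ′≗σ p)

  trace-agree : ∀ {σ σ′ x ys z} → Trace σ x ys z → (∀ w → w ∈ x ∷ ys → σ′ w ≡ σ w) → Trace σ′ x ys z
  trace-agree end agree = end
  trace-agree (next e p) agree = next (trans (agree _ (here refl)) e) (trace-agree p (λ w w∈ → agree w (there w∈)))

  trace-local : ∀ {σ σ′ x ys z} → Trace σ x ys z → Unique (x ∷ ys) →
                (∀ w → w ∈ x ∷ ys → w ≢ z → σ′ w ≡ σ w) → Trace σ′ x ys z
  trace-local end _ agree = end
  trace-local {x = x} {z = z} (next e p) (x∉ ∷ u) agree =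
    next (trans (agree x (here refl) x≢z) e) (trace-local p u (λ w w∈ → agree w (there w∈)))
    where
    x≢z : x ≢ z
    x≢z refl = Unique.Unique[x∷xs]⇒x∉xs (x∉ ∷ u) (trace-last∈ (next e p))

  rotate : ∀ {σ a zs x} → Trace σ a zs a → x ∈ zs → Σ (List (Fin n)) λ zs′ → Trace σ x zs′ x × zs′ ↭ zs
  rotate {σ} {a} {zs} {x} p x∈ with ∈-∃++ x∈
  ... | (pre , suf , refl) =
    let (q₁ , q₂) = trace-split pre x suf p in
    suf ++ pre ++ [ x ] , trace-++ q₂ q₁ ,
    ↭-trans (++-comm suf (pre ++ [ x ])) (↭-reflexive (++-assoc pre [ x ] suf))

  reroute : ∀ {σ σ′ c d ys} → Trace σ d ys d → d ∈ ys → Unique ys → c ∉ ys → σ′ c ≡ σ d →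
            (∀ w → w ≢ c → w ≢ d → σ′ w ≡ σ w) → Trace σ′ c ys d
  reroute end () _ _ _ _
  reroute {c = c} (next e p) _ u c∉ e′ agree =
    next (trans e′ e) (trace-local p u (λ w w∈ → agree w (λ { refl → c∉ w∈ })))

  -- Composing with the transposition (a b) merges the disjoint cycles of
  -- a and b into one.
  merge : ∀ {σ σ′ a b ysa ysb} → Trace σ a ysa a → Trace σ b ysb b →
          Unique ysa → Unique ysb → Disjoint ysa ysb → a ∈ ysa → b ∈ ysb →
          σ′ a ≡ σ b → σ′ b ≡ σ a → (∀ w → w ≢ a → w ≢ b → σ′ w ≡ σ w) →
          Trace σ′ a (ysb ++ ysa) a
  merge pa pb ua ub disjoint a∈ b∈ ea eb agree =
    trace-++ (reroute pb b∈ ub (λ a∈b → disjoint (a∈ , a∈b)) ea agree)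
             (reroute pa a∈ ua (λ b∈a → disjoint (b∈a , b∈)) eb (λ w w≢b w≢a → agree w w≢a w≢b))

  -- σ runs through the connected component of x in T(L) as one cycle:
  -- ys is the closed σ-trace of x and lists exactly that component.
  record CycleOn (σ : Fin n → Fin n) (L : List (Transp n)) (x : Fin n) : Set where
    constructor cycleOn
    field
      ys : List (Fin n)
      trace : Trace σ x ys x
      unique : Unique ys
      sound : ∀ {y} → y ∈ ys → Reach L x y
      complete : ∀ {y} → Reach L x y → y ∈ ys

  CycleOn-cong : ∀ {σ σ′ L L′ x} → (∀ w → σ′ w ≡ σ w) →
                 (∀ {y z} → Carries L y z → Carries L′ y z) → (∀ {y z} → Carries L′ y z → Carries L y z) →
                 CycleOn σ L x → CycleOn σ′ L′ x
  CycleOn-cong σ′≗σ L⇒L′ L′⇒L (cycleOn ys trace unique sound complete) =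
    cycleOn ys (trace-cong σ′≗σ trace) unique (λ y∈ → Star.map L⇒L′ (sound y∈))
            (λ w → complete (Star.map L′⇒L w))

  Separated : List (Transp n) → Set
  Separated [] = ⊤
  Separated (f ∷ q) = ¬ Reach q (fst f) (snd f) × Separated q

  Reach-there : ∀ {f : Transp n} {q x y} → Reach q x y → Reach (f ∷ q) x y
  Reach-there = Star.map there

  Reach-[] : ∀ {x y : Fin n} → Reach [] x y → x ≡ y
  Reach-[] ε = refl

  reach-split : ∀ {f : Transp n} {q x y} → Reach (f ∷ q) x y →
                Reach q x y ⊎ (Reach q x (fst f) × Reach q (snd f) y) ⊎ (Reach q x (snd f) × Reach q (fst f) y)
  reach-split ε = inj₁ ε
  reach-split (here (forward refl refl) ◅ w) with reach-split w
  ... | inj₁ w₁ = inj₂ (inj₁ (ε , w₁))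
  ... | inj₂ (inj₁ (_ , w₂)) = inj₂ (inj₁ (ε , w₂))
  ... | inj₂ (inj₂ (_ , w₂)) = inj₁ w₂
  reach-split (here (backward refl refl) ◅ w) with reach-split w
  ... | inj₁ w₁ = inj₂ (inj₂ (ε , w₁))
  ... | inj₂ (inj₁ (_ , w₂)) = inj₁ w₂
  ... | inj₂ (inj₂ (_ , w₂)) = inj₂ (inj₂ (ε , w₂))
  reach-split (there c ◅ w) with reach-split w
  ... | inj₁ w₁ = inj₁ (c ◅ w₁)
  ... | inj₂ (inj₁ (w₁ , w₂)) = inj₂ (inj₁ (c ◅ w₁ , w₂))
  ... | inj₂ (inj₂ (w₁ , w₂)) = inj₂ (inj₂ (c ◅ w₁ , w₂))

  module Join (f : Transp n) (q : List (Transp n)) (a↮b : ¬ Reach q (fst f) (snd f))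
              (cycles : ∀ x → CycleOn (applyWord q) q x) where

    a = fst f
    b = snd f
    σ = applyWord q
    σ′ = applyWord (f ∷ q)
    open CycleOn (cycles a) renaming (ys to ysa; trace to pa; unique to ua; sound to sa; complete to ca)
    open CycleOn (cycles b) renaming (ys to ysb; trace to pb; unique to ub; sound to sb; complete to cb)

    disjoint : Disjoint ysa ysb
    disjoint (wa , wb) = a↮b (sa wa ◅◅ Reach-sym (sb wb))

    merged : Trace σ′ a (ysb ++ ysa) a
    merged = merge pa pb ua ub disjoint (ca ε) (cb ε)
               (cong σ (swap-fst a b)) (cong σ (swap-snd a b)) (λ w w≢a w≢b → cong σ (swap-other w≢a w≢b))

    f-edge : Reach (f ∷ q) a b
    f-edge = here (onEdge-refl f) ◅ ε

    merged-sound : ∀ {y} → y ∈ ysb ++ ysa → Reach (f ∷ q) a y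
    merged-sound y∈ with ∈-++⁻ ysb y∈
    ... | inj₁ yb = f-edge ◅◅ Reach-there (sb yb)
    ... | inj₂ ya = Reach-there (sa ya)

    merged-complete : ∀ {y} → Reach (f ∷ q) a y → y ∈ ysb ++ ysa
    merged-complete w with reach-split w
    ... | inj₁ w₁ = ∈-++⁺ʳ ysb (ca w₁)
    ... | inj₂ (inj₁ (_ , w₂)) = ∈-++⁺ˡ (cb w₂)
    ... | inj₂ (inj₂ (w₁ , _)) = ⊥-elim (a↮b w₁)

    join : ∀ {x} → Reach q a x → CycleOn σ′ (f ∷ q) x
    join {x} a↝x =
      let (zs , trace , zs↭) = rotate merged (∈-++⁺ʳ ysb (ca a↝x)) in
      cycleOn zs trace
        (Permutationₛ.Unique-resp-↭ (setoid (Fin n)) (↭⇒↭ₛ (↭-sym zs↭))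
          (Unique.++⁺ ub ua (λ (wb , wa) → disjoint (wa , wb))))
        (λ y∈ → Reach-there (Reach-sym a↝x) ◅◅ merged-sound (∈-resp-↭ zs↭ y∈))
        (λ w → ∈-resp-↭ (↭-sym zs↭) (merged-complete (Reach-there a↝x ◅◅ w)))

    unchanged : ∀ {x} → ¬ Reach q a x → ¬ Reach q b x → CycleOn σ′ (f ∷ q) x
    unchanged {x} a↮x b↮x =
      cycleOn ys (trace-agree trace agree) unique (λ y∈ → Reach-there (sound y∈)) complete′
      where
      open CycleOn (cycles x)
      x↝ : ∀ {w} → w ∈ x ∷ ys → Reach q x w
      x↝ (here refl) = ε
      x↝ (there w∈) = sound w∈
      agree : ∀ w → w ∈ x ∷ ys → σ′ w ≡ σ w
      agree w w∈ = cong σ (swap-other (λ { refl → a↮x (Reach-sym (x↝ w∈)) }) (λ { refl → b↮x (Reach-sym (x↝ w∈)) }))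
      complete′ : ∀ {y} → Reach (f ∷ q) x y → y ∈ ys
      complete′ w with reach-split w
      ... | inj₁ w₁ = complete w₁
      ... | inj₂ (inj₁ (x↝a , _)) = ⊥-elim (a↮x (Reach-sym x↝a))
      ... | inj₂ (inj₂ (x↝b , _)) = ⊥-elim (b↮x (Reach-sym x↝b))

  flipT : Transp n → Transp n
  flipT f = tr (snd f) (fst f) (λ e → distinct f (sym e))

  flip-carries : ∀ {f q} {x y : Fin n} → Carries (flipT f ∷ q) x y → Carries (f ∷ q) x y
  flip-carries (here (forward p q)) = here (backward q p)
  flip-carries (here (backward p q)) = here (forward q p)
  flip-carries (there c) = there c

  unflip-carries : ∀ {f q} {x y : Fin n} → Carries (f ∷ q) x y → Carries (flipT f ∷ q) x y
  unflip-carries (here (forward p q)) = here (backward q p)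
  unflip-carries (here (backward p q)) = here (forward q p)
  unflip-carries (there c) = there c

  cycles-∷ : ∀ f q → ¬ Reach q (fst f) (snd f) → (∀ x → CycleOn (applyWord q) q x) →
             ∀ x → CycleOn (applyWord (f ∷ q)) (f ∷ q) x
  cycles-∷ f q a↮b cycles x with x ∈? CycleOn.ys (cycles (fst f)) | x ∈? CycleOn.ys (cycles (snd f))
  ... | yes x∈a | _ = Join.join f q a↮b cycles (CycleOn.sound (cycles (fst f)) x∈a)
  ... | no _ | yes x∈b =
    CycleOn-cong (λ w → cong (applyWord q) (swap-comm (fst f) (snd f) w)) flip-carries unflip-carries
      (Join.join (flipT f) q (λ w → a↮b (Reach-sym w)) cycles (CycleOn.sound (cycles (snd f)) x∈b))
  ... | no x∉a | no x∉b =
    Join.unchanged f q a↮b cycles (λ w → x∉a (CycleOn.complete (cycles (fst f)) w))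
                                  (λ w → x∉b (CycleOn.complete (cycles (snd f)) w))

  separated⇒cycles : ∀ q → Separated q → ∀ x → CycleOn (applyWord q) q x
  separated⇒cycles [] _ x =
    cycleOn [ x ] (next refl end) (All.[] ∷ []) (λ { (here refl) → ε }) (λ w → here (sym (Reach-[] w)))
  separated⇒cycles (f ∷ q) (a↮b , separated) = cycles-∷ f q a↮b (separated⇒cycles q separated)

  cycle-moves : ∀ {σ L x} → CycleOn σ L x → ∀ {y} → Reach L x y → y ≢ x → σ x ≢ x
  cycle-moves {σ} {x = x} (cycleOn ys trace unique _ complete) {y} x↝y y≢x σx≡x = go trace unique (complete x↝y)
    where
    go : ∀ {zs} → Trace σ x zs x → Unique zs → y ∈ zs → ⊥
    go (next e end) _ (here refl) = y≢x (trans (sym e) σx≡x)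
    go (next e p@(next _ _)) (z∉ ∷ _) _ = All.lookup z∉ (trace-last∈ p) (trans (sym e) σx≡x)

module _ {n : ℕ} where

  removeEdge : Transp n → List (Transp n) → List (Transp n)
  removeEdge t [] = []
  removeEdge t (s ∷ K) with onEdge? s (fst t) (snd t)
  ... | yes _ = removeEdge t K
  ... | no _ = s ∷ removeEdge t K

  mult-removeEdge-on : ∀ t K {x y} → OnEdge t x y → mult (removeEdge t K) x y ≡ 0
  mult-removeEdge-on t [] on = refl
  mult-removeEdge-on t (s ∷ K) on with onEdge? s (fst t) (snd t)
  ... | yes _ = mult-removeEdge-on t K on
  ... | no s-off = trans (mult-off (removeEdge t K) off) (mult-removeEdge-on t K on)
    where off = λ s-on → s-off (OnEdge-SameEdge s-on (SameEdge-sym (OnEdge⇒SameEdge on)))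

  mult-removeEdge-off : ∀ t K {x y} → ¬ OnEdge t x y → mult (removeEdge t K) x y ≡ mult K x y
  mult-removeEdge-off t [] off = refl
  mult-removeEdge-off t (s ∷ K) {x} {y} off with onEdge? s (fst t) (snd t) | onEdge? s x y
  ... | yes s-on | yes s-on′ = ⊥-elim (off (OnEdge-SameEdge (onEdge-refl t)
          (SameEdge-trans (SameEdge-sym (OnEdge⇒SameEdge s-on)) (OnEdge⇒SameEdge s-on′))))
  ... | yes _ | no s-off = trans (mult-removeEdge-off t K off) (sym (mult-off K s-off))
  ... | no _ | yes s-on = trans (mult-on (removeEdge t K) s-on)
                            (trans (cong suc (mult-removeEdge-off t K off)) (sym (mult-on K s-on)))
  ... | no _ | no s-off = trans (mult-off (removeEdge t K) s-off)
                            (trans (mult-removeEdge-off t K off) (sym (mult-off K s-off)))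

  removeEdge-⊆ : ∀ t K {s} → s ∈ removeEdge t K → s ∈ K
  removeEdge-⊆ t (s′ ∷ K) s∈ with onEdge? s′ (fst t) (snd t) | s∈
  ... | yes _ | s∈′ = there (removeEdge-⊆ t K s∈′)
  ... | no _ | here e = here e
  ... | no _ | there s∈′ = there (removeEdge-⊆ t K s∈′)

  reduce : List (Transp n) → List (Transp n)
  reduce [] = []
  reduce (t ∷ L) with 0 <? mult (reduce L) (fst t) (snd t)
  ... | yes _ = removeEdge t (reduce L)
  ... | no _ = t ∷ reduce L

  suc-%2 : ∀ m → suc m % 2 ≡ 1 ∸ m % 2
  suc-%2 zero = refl
  suc-%2 (suc zero) = refl
  suc-%2 (suc (suc m)) = suc-%2 m

  mult-reduce : ∀ L x y → mult (reduce L) x y ≡ mult L x y % 2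
  mult-reduce [] x y = refl
  mult-reduce (t ∷ L) x y with 0 <? mult (reduce L) (fst t) (snd t) | onEdge? t x y
  ... | yes present | yes on = begin
    mult (removeEdge t (reduce L)) x y ≡⟨ mult-removeEdge-on t (reduce L) on ⟩
    0                                  ≡⟨ sym (ℕₚ.m≤n⇒m∸n≡0 (subst (1 ≤_) odd present)) ⟩
    1 ∸ mult L x y % 2                 ≡⟨ sym (suc-%2 (mult L x y)) ⟩
    suc (mult L x y) % 2               ≡⟨ cong (_% 2) (sym (mult-on L on)) ⟩
    mult (t ∷ L) x y % 2               ∎
    where
    open ≡-Reasoning
    odd : mult (reduce L) (fst t) (snd t) ≡ mult L x y % 2
    odd = trans (mult-SameEdge (reduce L) (OnEdge⇒SameEdge on)) (mult-reduce L x y)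
  ... | yes _ | no off = trans (mult-removeEdge-off t (reduce L) off)
                           (trans (mult-reduce L x y) (cong (_% 2) (sym (mult-off L off))))
  ... | no absent | yes on = begin
    mult (t ∷ reduce L) x y     ≡⟨ mult-on (reduce L) on ⟩
    suc (mult (reduce L) x y)   ≡⟨ cong suc none ⟩
    1                           ≡⟨ cong (1 ∸_) (sym (trans (sym (mult-reduce L x y)) none)) ⟩
    1 ∸ mult L x y % 2          ≡⟨ sym (suc-%2 (mult L x y)) ⟩
    suc (mult L x y) % 2        ≡⟨ cong (_% 2) (sym (mult-on L on)) ⟩
    mult (t ∷ L) x y % 2        ∎
    where
    open ≡-Reasoning
    none : mult (reduce L) x y ≡ 0
    none = trans (sym (mult-SameEdge (reduce L) (OnEdge⇒SameEdge on))) (ℕₚ.n≤0⇒n≡0 (ℕₚ.≮⇒≥ absent))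
  ... | no _ | no off = trans (mult-off (reduce L) off)
                          (trans (mult-reduce L x y) (cong (_% 2) (sym (mult-off L off))))

  reduce-⊆ : ∀ L {s} → s ∈ reduce L → s ∈ L
  reduce-⊆ (t ∷ L) s∈ with 0 <? mult (reduce L) (fst t) (snd t) | s∈
  ... | yes _ | s∈′ = there (reduce-⊆ L (removeEdge-⊆ t (reduce L) s∈′))
  ... | no _ | here e = here e
  ... | no _ | there s∈′ = there (reduce-⊆ L s∈′)

module Matching {n : ℕ} (M : Fin n → Fin n → Set) (M? : ∀ x y → Dec (M x y))
                (M-sym : ∀ {x y} → M x y → M y x)
                (M-functional : ∀ {x y y′} → M x y → M x y′ → y ≡ y′) where

  Matched : Transp n → Set
  Matched t = M (fst t) (snd t)

  M-SameEdge : ∀ {a b x y} → M a b → SameEdge a b x y → M x y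
  M-SameEdge m (inj₁ (refl , refl)) = m
  M-SameEdge m (inj₂ (refl , refl)) = M-sym m

  Unmatched : Fin n → Set
  Unmatched x = ∀ y → ¬ M x y

  matched? : ∀ x → (∃ λ y → M x y) ⊎ Unmatched x
  matched? x with any? (M? x)
  ... | yes (y , m) = inj₁ (y , m)
  ... | no none = inj₂ (λ y m → none (y , m))

  matched-touch : ∀ {t x y} → Matched t → Touches t x → M x y → OnEdge t x y
  matched-touch m (at-fst refl) m′ with M-functional m m′
  ... | refl = forward refl refl
  matched-touch m (at-snd refl) m′ with M-functional (M-sym m) m′
  ... | refl = backward refl refl

  partner : ∀ {t x} → Matched t → Touches t x → ∃ λ y → M x y × OnEdge t x y
  partner {t} m (at-fst refl) = snd t , m , forward refl refl
  partner {t} m (at-snd refl) = fst t , M-sym m , backward refl refl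

  toggle : ℕ → Fin n → Fin n → Fin n
  toggle zero x y = x
  toggle (suc k) x y = toggle k y x

  toggle-%2 : ∀ k x y → toggle (k % 2) x y ≡ toggle k x y
  toggle-%2 zero x y = refl
  toggle-%2 (suc zero) x y = refl
  toggle-%2 (suc (suc k)) x y = toggle-%2 k x y

  word-matched : ∀ L → All Matched L → ∀ {x y} → M x y → applyWord L x ≡ toggle (mult L x y) x y
  word-matched [] _ m = refl
  word-matched (t ∷ L) (mt ∷ mL) {x} {y} m with touches? t x
  ... | yes tx = let on = matched-touch mt tx m in begin
      applyWord L (apply t x)       ≡⟨ cong (applyWord L) (apply-on on) ⟩
      applyWord L y                 ≡⟨ word-matched L mL (M-sym m) ⟩
      toggle (mult L y x) y x       ≡⟨ cong (λ k → toggle k y x) (mult-sym L y x) ⟩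
      toggle (mult L x y) y x       ≡⟨ cong (λ k → toggle k x y) (sym (mult-on L on)) ⟩
      toggle (mult (t ∷ L) x y) x y ∎
    where open ≡-Reasoning
  ... | no tx = trans (cong (applyWord L) (apply-untouched tx))
                  (trans (word-matched L mL m) (cong (λ k → toggle k x y) (sym (mult-off L (untouched-off tx)))))

  word-unmatched : ∀ L → All Matched L → ∀ {x} → Unmatched x → applyWord L x ≡ x
  word-unmatched [] _ _ = refl
  word-unmatched (t ∷ L) (mt ∷ mL) {x} free with touches? t x
  ... | yes tx = let (y , m , _) = partner mt tx in ⊥-elim (free y m)
  ... | no tx = trans (cong (applyWord L) (apply-untouched tx)) (word-unmatched L mL free)

  same-parity⇒same-word : ∀ L L′ → All Matched L → All Matched L′ →
                          (∀ {x y} → M x y → mult L x y % 2 ≡ mult L′ x y % 2) →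
                          ∀ x → applyWord L x ≡ applyWord L′ x
  same-parity⇒same-word L L′ mL mL′ parity x with matched? x
  ... | inj₂ free = trans (word-unmatched L mL free) (sym (word-unmatched L′ mL′ free))
  ... | inj₁ (y , m) = begin
    applyWord L x                   ≡⟨ word-matched L mL m ⟩
    toggle (mult L x y) x y         ≡⟨ sym (toggle-%2 (mult L x y) x y) ⟩
    toggle (mult L x y % 2) x y     ≡⟨ cong (λ k → toggle k x y) (parity m) ⟩
    toggle (mult L′ x y % 2) x y    ≡⟨ toggle-%2 (mult L′ x y) x y ⟩
    toggle (mult L′ x y) x y        ≡⟨ sym (word-matched L′ mL′ m) ⟩
    applyWord L′ x                  ∎
    where open ≡-Reasoning

  InPair : Fin n → Fin n → Fin n → Set
  InPair a b z = z ≡ a ⊎ z ≡ b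

  apply-pair : ∀ p {a b z} → Matched p → M a b → InPair a b z → InPair a b (apply p z)
  apply-pair p {z = z} mp m z∈ab with touches? p z
  ... | no pz = subst (InPair _ _) (sym (apply-untouched pz)) z∈ab
  apply-pair p mp m (inj₁ refl) | yes pz = inj₂ (apply-on (matched-touch mp pz m))
  apply-pair p mp m (inj₂ refl) | yes pz = inj₁ (apply-on (matched-touch mp pz (M-sym m)))

  relabel-pair : ∀ P {a b z} → All Matched P → M a b → InPair a b z → InPair a b (relabel P z)
  relabel-pair [] _ _ z∈ab = z∈ab
  relabel-pair (p ∷ P) (mp ∷ mP) m z∈ab = apply-pair p mp m (relabel-pair P mP m z∈ab)

  relabel-pair⁻ : ∀ P {a b z} → All Matched P → M a b → InPair a b (relabel P z) → InPair a b z
  relabel-pair⁻ [] _ _ z∈ab = z∈ab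
  relabel-pair⁻ (p ∷ P) {z = z} (mp ∷ mP) m z∈ab =
    relabel-pair⁻ P mP m (subst (InPair _ _) (swap-involutive (fst p) (snd p) (relabel P z)) (apply-pair p mp m z∈ab))

  relabel-unmatched : ∀ P {z} → All Matched P → Unmatched z → relabel P z ≡ z
  relabel-unmatched [] _ _ = refl
  relabel-unmatched (p ∷ P) {z} (mp ∷ mP) free rewrite relabel-unmatched P mP free with touches? p z
  ... | yes pz = let (y , m , _) = partner mp pz in ⊥-elim (free y m)
  ... | no pz = apply-untouched pz

  relabel-hop : ∀ P z → All Matched P → Star M (relabel P z) z
  relabel-hop [] z _ = ε
  relabel-hop (p ∷ P) z (mp ∷ mP) = hop (relabel P z) ◅◅ relabel-hop P z mP
    where
    hop : ∀ w → Star M (apply p w) w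
    hop w with touches? p w
    ... | yes pw = let (y , m , on) = partner mp pw in subst (λ v → Star M v w) (sym (apply-on on)) (M-sym m ◅ ε)
    ... | no pw = subst (λ v → Star M v w) (sym (apply-untouched pw)) ε

  carried-matched : ∀ {K x y} → All Matched K → Carries K x y → M x y
  carried-matched mK c = let (t , t∈ , on) = find c in M-SameEdge (All.lookup mK t∈) (OnEdge⇒SameEdge on)

  -- A matched word using each transposition at most once is separated:
  -- its edges are pairwise disjoint.
  matched-separated : ∀ K → All Matched K → (∀ x y → mult K x y ≤ 1) → Separated K
  matched-separated [] _ _ = _
  matched-separated (t ∷ K) (mt ∷ mK) once =
    no-walk , matched-separated K mK (λ x y → ℕₚ.≤-trans (mult-∷-≤ t K x y) (once x y))
    where
    no-walk : ¬ Reach K (fst t) (snd t)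
    no-walk ε = distinct t refl
    no-walk (c ◅ _) with M-functional mt (carried-matched mK c)
    ... | refl = ℕₚ.<⇒≱ (s≤s (Carries⇒mult-pos K c))
                   (subst (_≤ 1) (mult-on K (onEdge-refl t)) (once (fst t) (snd t)))

-- The nonsimple multiedges of T(u) form a matching (hypothesis (1)).
module NonSimpleMatching {n : ℕ} (u : List (Transp n))
    (one-nonsimple : ∀ (v w w′ : Fin n) → NonSimple u v w → NonSimple u v w′ → w ≡ w′) where

  nonSimple? : ∀ x y → Dec (NonSimple u x y)
  nonSimple? x y = 2 ≤? mult u x y

  NonSimple-sym : ∀ {x y} → NonSimple u x y → NonSimple u y x
  NonSimple-sym {x} {y} = subst (2 ≤_) (mult-sym u x y)

  open Matching (NonSimple u) nonSimple? NonSimple-sym (λ {x} {y} {y′} → one-nonsimple x y y′) public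
  open Sort {Keep = Matched} (λ t → nonSimple? (fst t) (snd t)) public

  NonSimple⇒Carries : ∀ {x y} → NonSimple u x y → Carries u x y
  NonSimple⇒Carries ns = mult-pos⇒Carries u (ℕₚ.≤-trans (s≤s z≤n) ns)

  nonsimple-avoids : ∀ {a b x y} → ¬ NonSimple u a b → NonSimple u x y → Avoiding u a b x y
  nonsimple-avoids simple ns = NonSimple⇒Carries ns , λ same → simple (M-SameEdge ns (SameEdge-sym same))

  -- The normal form of a rearrangement r of u: the simple terms, each
  -- conjugated by the nonsimple terms preceding it, followed by one copy
  -- of each nonsimple edge of odd multiplicity.
  module Rearrangement (r : List (Transp n)) (r↭u : r ↭ u) where

    simplePart : List (Transp n)
    simplePart = moved [] r

    oddPart : List (Transp n)
    oddPart = reduce (kept r)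

    normal : List (Transp n)
    normal = simplePart ++ oddPart

    mult-oddPart : ∀ {x y} → NonSimple u x y → mult oddPart x y ≡ mult u x y % 2
    mult-oddPart {x} {y} ns = trans (mult-reduce (kept r) x y)
      (cong (_% 2) (trans (mult-kept r (λ on → M-SameEdge ns (SameEdge-sym (OnEdge⇒SameEdge on)))) (mult-↭ r↭u x y)))

    oddPart-matched : All Matched oddPart
    oddPart-matched = All.tabulate (λ s∈ → All.lookup (kept-Keep r) (reduce-⊆ (kept r) s∈))

    oddPart-once : ∀ x y → mult oddPart x y ≤ 1
    oddPart-once x y = subst (_≤ 1) (sym (mult-reduce (kept r) x y)) (ℕₚ.≤-pred (m%n<n (mult (kept r) x y) 2))

    applyWord-normal : ∀ x → applyWord r x ≡ applyWord normal x
    applyWord-normal x = begin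
      applyWord r x                                   ≡⟨ sort r x ⟩
      applyWord (kept r) (applyWord simplePart x)
        ≡⟨ same-parity⇒same-word (kept r) oddPart (kept-Keep r) oddPart-matched
             (λ {x} {y} _ → sym (trans (cong (_% 2) (mult-reduce (kept r) x y)) (m%n%n≡m%n (mult (kept r) x y) 2))) _ ⟩
      applyWord oddPart (applyWord simplePart x)      ≡⟨ sym (applyWord-++ simplePart oddPart x) ⟩
      applyWord normal x                              ∎
      where open ≡-Reasoning

    -- The normal form is separated: a walk joining the ends of a conjugated
    -- simple term t = (a b) would, after undoing the conjugations (which
    -- move points only along nonsimple edges), bypass the edge {a, b} of
    -- the tree T(u).
    module _ (acyclic : Acyclic u) where

      module Bypass (P : List (Transp n)) (t : Transp n) (q : List (Transp n))
                    (P-matched : All Matched P) (simple : ¬ Matched t)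
                    (t∷q≤u : ∀ x y → mult (t ∷ q) x y ≤ mult u x y) where
        a = fst t
        b = snd t

        -- Terms of q are steps of T(u) avoiding {a, b}: the edge {a, b}
        -- occurs only once in t ∷ q, being simple.
        term-avoids : ∀ {s} → s ∈ q → Avoiding u a b (fst s) (snd s)
        term-avoids {s} s∈ =
          mult-pos⇒Carries u (ℕₚ.≤-trans (Carries⇒mult-pos q s∈q) (ℕₚ.≤-trans (mult-∷-≤ t q _ _) (t∷q≤u _ _))) ,
          λ same → simple (ℕₚ.≤-trans (twice same) (t∷q≤u a b))
          where
          s∈q : Carries q (fst s) (snd s)
          s∈q = lose s∈ (onEdge-refl s)
          twice : SameEdge a b (fst s) (snd s) → 2 ≤ mult (t ∷ q) a b
          twice same = subst (2 ≤_) (sym (mult-on q (onEdge-refl t)))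
                         (s≤s (subst (0 <_) (sym (mult-SameEdge q same)) (Carries⇒mult-pos q s∈q)))

        hops : ∀ Q z → All Matched Q → Star (Avoiding u a b) (relabel Q z) z
        hops Q z Q-matched = Star.map (nonsimple-avoids simple) (relabel-hop Q z Q-matched)

        conjugate-avoids : ∀ {Q s} → All Matched Q → s ∈ q →
                           Star (Avoiding u a b) (fst (conjugateBy Q s)) (snd (conjugateBy Q s))
        conjugate-avoids {Q} {s} Q-matched s∈ =
          hops Q (fst s) Q-matched ◅◅ term-avoids s∈ ◅ Star.reverse Avoiding-sym (hops Q (snd s) Q-matched)

        step-avoids : ∀ {x y} → Carries (moved P q ++ oddPart) x y → Star (Avoiding u a b) x y
        step-avoids c with Anyₚ.++⁻ (moved P q) c
        ... | inj₂ c′ = nonsimple-avoids simple (carried-matched oddPart-matched c′) ◅ ε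
        ... | inj₁ c′ with find c′
        ...   | (g , g∈ , on) with origin-of P q P-matched g∈
        ...     | origin Q-matched s∈ _ refl with on
        ...       | forward refl refl = conjugate-avoids Q-matched s∈
        ...       | backward refl refl = Star.reverse Avoiding-sym (conjugate-avoids Q-matched s∈)

        no-bypass : ¬ Reach (moved P q ++ oddPart) (fst (conjugateBy P t)) (snd (conjugateBy P t))
        no-bypass w = edge-is-bridge acyclic (distinct t)
          (mult-pos⇒Carries u (ℕₚ.≤-trans (Carries⇒mult-pos (t ∷ q) (here (onEdge-refl t))) (t∷q≤u a b)))
          (Star.reverse Avoiding-sym (hops P a P-matched) ◅◅ (w >>= step-avoids) ◅◅ hops P b P-matched)

      -- Invariant: P holds the nonsimple terms already moved past, and q
      -- is a part of r, so its multiplicities are bounded by those of u.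
      moved-separated : ∀ P q → All Matched P → (∀ x y → mult q x y ≤ mult u x y) → Separated (moved P q ++ oddPart)
      moved-separated P [] _ _ = matched-separated oddPart oddPart-matched oddPart-once
      moved-separated P (t ∷ q) P-matched q≤u with nonSimple? (fst t) (snd t)
      ... | yes m = moved-separated (P ++ [ t ]) q (Allₚ.++⁺ P-matched (m ∷ []))
                      (λ x y → ℕₚ.≤-trans (mult-∷-≤ t q x y) (q≤u x y))
      ... | no simple = Bypass.no-bypass P t q P-matched simple q≤u ,
                        moved-separated P q P-matched (λ x y → ℕₚ.≤-trans (mult-∷-≤ t q x y) (q≤u x y))

      normal-separated : Separated normal
      normal-separated = moved-separated [] r [] (λ x y → ℕₚ.≤-reflexive (mult-↭ r↭u x y))

-- Then H-walks between live points can be replaced by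
-- A-walks, since a walk entering a dead point must return the same way.
module DeadEnds {n : ℕ} {H A : Fin n → Fin n → Set} {Dead : Fin n → Set}
    (H-split : ∀ {x y} → H x y → A x y ⊎ Dead x ⊎ Dead y)
    (dead-end : ∀ {z y₁ y₂} → Dead z → H z y₁ → H z y₂ → y₁ ≡ y₂)
    (A-live : ∀ {x y} → A x y → ¬ Dead y)
    (H-sym : ∀ {x y} → H x y → H y x) where

  mutual
    prune : ∀ {x y} → ¬ Dead x → Star H x y → ¬ Dead y → Star A x y
    prune x-live ε y-live = ε
    prune x-live (h ◅ w) y-live with H-split h
    ... | inj₁ a = a ◅ prune (A-live a) w y-live
    ... | inj₂ (inj₁ x-dead) = ⊥-elim (x-live x-dead)
    ... | inj₂ (inj₂ z-dead) = step-back z-dead (H-sym h) x-live w y-live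

    step-back : ∀ {z x y} → Dead z → H z x → ¬ Dead x → Star H z y → ¬ Dead y → Star A x y
    step-back z-dead zx x-live ε y-live = ⊥-elim (y-live z-dead)
    step-back z-dead zx x-live (h ◅ w) y-live with dead-end z-dead h zx
    ... | refl = prune x-live w y-live

EvenPos⇒2≤ : ∀ {k} → EvenPos k → 2 ≤ k
EvenPos⇒2≤ {suc zero} (_ , ())
EvenPos⇒2≤ {suc (suc k)} _ = s≤s (s≤s z≤n)

module Analysis {n : ℕ} (u : List (Transp n))
    (one-nonsimple : ∀ (v w w′ : Fin n) → NonSimple u v w → NonSimple u v w′ → w ≡ w′)
    (even-twig : ∀ (x y : Fin n) → EvenPos (mult u x y) →
       (Multitwig u x y × ExactlyTwoNeighbors u y) ⊎ (Multitwig u y x × ExactlyTwoNeighbors u x))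
    (r : List (Transp n)) (r↭u : r ↭ u) where

  open NonSimpleMatching u one-nonsimple public
  open Rearrangement r r↭u public

  Untouched : Fin n → Set
  Untouched z = ¬ Touched normal z

  term-adjacent : ∀ {s} → s ∈ u → Adj u (fst s) (snd s)
  term-adjacent s∈ = Carries⇒mult-pos u (lose s∈ (onEdge-refl _))

  term-adjacent′ : ∀ {s} → s ∈ u → Adj u (snd s) (fst s)
  term-adjacent′ s∈ = Carries⇒mult-pos u (Carries-sym (lose s∈ (onEdge-refl _)))

  simple-survives : ∀ {s} → s ∈ u → ¬ Matched s → ∃ λ Q → All Matched Q × conjugateBy Q s ∈ normal
  simple-survives s∈ simple =
    let (Q , Q-matched , g∈) = moved-of [] r [] (∈-resp-↭ (↭-sym r↭u) s∈) simple in
    Q , Q-matched , ∈-++⁺ˡ g∈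

  odd-present : ∀ {x y} → NonSimple u x y → ¬ mult u x y % 2 ≡ 0 → Carries normal x y
  odd-present ns odd = Anyₚ.++⁺ʳ simplePart
    (mult-pos⇒Carries oddPart (ℕₚ.n≢0⇒n>0 (λ e → odd (trans (sym (mult-oddPart ns)) e))))

  record Twig (a b : Fin n) : Set where
    field
      leaf middle other : Fin n
      same : SameEdge leaf middle a b
      leaf-only : ∀ z → Adj u leaf z → z ≡ middle
      middle-two : ∀ z → Adj u middle z → z ≡ leaf ⊎ z ≡ other
      middle-other : Adj u middle other
      other-simple : ¬ NonSimple u middle other
      nonsimple : NonSimple u leaf middle

  -- The middle's neighbours are the leaf and one other point, joined to
  -- it by a simple edge since the middle already has the nonsimple edge.
  mkTwig : ∀ {a b} l m → (∀ z → Adj u l z → z ≡ m) → ExactlyTwoNeighbors u m →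
           SameEdge l m a b → NonSimple u l m → Twig a b
  mkTwig l m leaf-only (z₁ , z₂ , z₁≢z₂ , m-z₁ , m-z₂ , two) same ns
    with two l (Carries⇒mult-pos u (Carries-sym (NonSimple⇒Carries ns)))
  ... | inj₁ refl = record
    { leaf = l ; middle = m ; other = z₂ ; same = same ; leaf-only = leaf-only ; middle-two = two
    ; middle-other = m-z₂ ; other-simple = λ ns′ → z₁≢z₂ (sym (one-nonsimple m z₂ l ns′ (NonSimple-sym ns)))
    ; nonsimple = ns }
  ... | inj₂ refl = record
    { leaf = l ; middle = m ; other = z₁ ; same = same ; leaf-only = leaf-only
    ; middle-two = λ z mz → Sum.swap (two z mz)
    ; middle-other = m-z₁ ; other-simple = λ ns′ → z₁≢z₂ (one-nonsimple m z₁ l ns′ (NonSimple-sym ns))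
    ; nonsimple = ns }

  twig : ∀ {a b} → EvenPos (mult u a b) → Twig a b
  twig {a} {b} ep with even-twig a b ep
  ... | inj₁ ((_ , leaf-only) , two) = mkTwig a b leaf-only two (inj₁ (refl , refl)) (EvenPos⇒2≤ ep)
  ... | inj₂ ((_ , leaf-only) , two) =
    mkTwig b a leaf-only two (inj₂ (refl , refl)) (NonSimple-sym (EvenPos⇒2≤ ep))

  TouchesPair : Fin n → Fin n → Transp n → Set
  TouchesPair a b t = InPair a b (fst t) ⊎ InPair a b (snd t)

  inPair? : ∀ a b z → Dec (InPair a b z)
  inPair? a b z = (z ≟ a) ⊎-dec (z ≟ b)

  touchesPair? : ∀ a b t → Dec (TouchesPair a b t)
  touchesPair? a b t = inPair? a b (fst t) ⊎-dec inPair? a b (snd t)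

  -- Exactly one end of an even multiedge {a, b} is untouched.
  module EvenEdge {a b : Fin n} (ep : EvenPos (mult u a b)) where
    open Twig (twig ep)

    ab : NonSimple u a b
    ab = EvenPos⇒2≤ ep

    toTwig : ∀ {z} → InPair a b z → z ≡ leaf ⊎ z ≡ middle
    toTwig z∈ab with same | z∈ab
    ... | inj₁ (l≡a , m≡b) | inj₁ z≡a = inj₁ (trans z≡a (sym l≡a))
    ... | inj₁ (l≡a , m≡b) | inj₂ z≡b = inj₂ (trans z≡b (sym m≡b))
    ... | inj₂ (l≡b , m≡a) | inj₁ z≡a = inj₂ (trans z≡a (sym m≡a))
    ... | inj₂ (l≡b , m≡a) | inj₂ z≡b = inj₁ (trans z≡b (sym l≡b))

    fromTwig : ∀ {z} → z ≡ leaf ⊎ z ≡ middle → InPair a b z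
    fromTwig z∈lm with same | z∈lm
    ... | inj₁ (l≡a , m≡b) | inj₁ z≡l = inj₁ (trans z≡l l≡a)
    ... | inj₁ (l≡a , m≡b) | inj₂ z≡m = inj₂ (trans z≡m m≡b)
    ... | inj₂ (l≡b , m≡a) | inj₁ z≡l = inj₂ (trans z≡l l≡b)
    ... | inj₂ (l≡b , m≡a) | inj₂ z≡m = inj₁ (trans z≡m m≡a)

    simple-at-pair : ∀ {s} → s ∈ u → ¬ Matched s → TouchesPair a b s → OnEdge s middle other
    simple-at-pair {s} s∈ simple touch with touch
    ... | inj₁ s₁∈ab with toTwig s₁∈ab
    ...   | inj₁ refl = ⊥-elim (simple (M-SameEdge nonsimple (inj₁ (refl , sym (leaf-only _ (term-adjacent s∈))))))
    ...   | inj₂ refl with middle-two _ (term-adjacent s∈)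
    ...     | inj₁ s₂≡l = ⊥-elim (simple (M-SameEdge nonsimple (inj₂ (sym s₂≡l , refl))))
    ...     | inj₂ s₂≡o = forward refl s₂≡o
    simple-at-pair {s} s∈ simple touch | inj₂ s₂∈ab with toTwig s₂∈ab
    ...   | inj₁ refl = ⊥-elim (simple (M-SameEdge nonsimple (inj₂ (refl , sym (leaf-only _ (term-adjacent′ s∈))))))
    ...   | inj₂ refl with middle-two _ (term-adjacent′ s∈)
    ...     | inj₁ s₁≡l = ⊥-elim (simple (M-SameEdge nonsimple (inj₁ (sym s₁≡l , refl))))
    ...     | inj₂ s₁≡o = backward s₁≡o refl

    conjugation-invariant : ∀ {Q t} → All Matched Q →
      (TouchesPair a b t → TouchesPair a b (conjugateBy Q t)) × (TouchesPair a b (conjugateBy Q t) → TouchesPair a b t)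
    conjugation-invariant {Q} Q-matched =
      Sum.map (relabel-pair Q Q-matched ab) (relabel-pair Q Q-matched ab) ,
      Sum.map (relabel-pair⁻ Q Q-matched ab) (relabel-pair⁻ Q Q-matched ab)

    -- At most one term of the simple part touches the pair, since they come
    -- from the occurrences of the simple edge {middle, other}.
    simple-touching-≤1 : count (touchesPair? a b) simplePart ≤ 1
    simple-touching-≤1 = begin
      count (touchesPair? a b) simplePart
        ≡⟨ count-moved (touchesPair? a b) (λ {Q} {t} → conjugation-invariant {Q} {t}) [] r [] ⟩
      count (λ t → ¬? (nonSimple? (fst t) (snd t)) ×-dec touchesPair? a b t) r
        ≤⟨ count-mono _ (λ t → isEdge middle other t ≟ᵇ true) r
             (λ t∈ (simple , touch) → onEdge⇒isEdge (simple-at-pair (∈-resp-↭ r↭u t∈) simple touch)) ⟩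
      mult r middle other   ≡⟨ mult-↭ r↭u middle other ⟩
      mult u middle other   ≤⟨ ℕₚ.≤-pred (ℕₚ.≰⇒> other-simple) ⟩
      1                     ∎
      where open ℕₚ.≤-Reasoning

    a≢b : a ≢ b
    a≢b a≡b = ℕₚ.<⇒≱ (subst (NonSimple u a) (sym a≡b) ab)
                       (ℕₚ.≤-trans (ℕₚ.≤-reflexive (mult-irreflexive u a)) z≤n)

    touches-pair : ∀ {t} → TouchesPair a b t → Touches t a ⊎ Touches t b
    touches-pair (inj₁ (inj₁ p)) = inj₁ (at-fst p)
    touches-pair (inj₁ (inj₂ p)) = inj₂ (at-fst p)
    touches-pair (inj₂ (inj₁ p)) = inj₁ (at-snd p)
    touches-pair (inj₂ (inj₂ p)) = inj₂ (at-snd p)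

    -- The odd part avoids the pair: {a, b} has even multiplicity.
    oddPart-avoids : ∀ {t} → t ∈ oddPart → ¬ TouchesPair a b t
    oddPart-avoids {t} t∈ touch =
      ℕₚ.<⇒≢ (Carries⇒mult-pos oddPart (lose t∈ on)) (sym (trans (mult-oddPart ab) (proj₂ ep)))
      where
      mt = All.lookup oddPart-matched t∈
      on : OnEdge t a b
      on with touches-pair touch
      ... | inj₁ ta = matched-touch mt ta ab
      ... | inj₂ tb = OnEdge-flip (matched-touch mt tb (NonSimple-sym ab))

    touching-simple : ∀ {g} → g ∈ normal → TouchesPair a b g → g ∈ simplePart
    touching-simple g∈ touch with ∈-++⁻ simplePart g∈
    ... | inj₁ g∈simple = g∈simple
    ... | inj₂ g∈odd = ⊥-elim (oddPart-avoids g∈odd touch)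

    ends-in-pair : ∀ {g} → Touches g a → Touches g b → InPair a b (fst g) × InPair a b (snd g)
    ends-in-pair (at-fst p) (at-fst q) = ⊥-elim (a≢b (trans (sym p) q))
    ends-in-pair (at-fst p) (at-snd q) = inj₁ p , inj₂ q
    ends-in-pair (at-snd p) (at-fst q) = inj₂ q , inj₁ p
    ends-in-pair (at-snd p) (at-snd q) = ⊥-elim (a≢b (trans (sym p) q))

    pair-edge : ∀ {x y} → InPair a b x → InPair a b y → x ≢ y → SameEdge x y a b
    pair-edge (inj₁ x≡a) (inj₁ y≡a) x≢y = ⊥-elim (x≢y (trans x≡a (sym y≡a)))
    pair-edge (inj₁ x≡a) (inj₂ y≡b) x≢y = inj₁ (x≡a , y≡b)
    pair-edge (inj₂ x≡b) (inj₁ y≡a) x≢y = inj₂ (x≡b , y≡a)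
    pair-edge (inj₂ x≡b) (inj₂ y≡b) x≢y = ⊥-elim (x≢y (trans x≡b (sym y≡b)))

    -- No term of the simple part moves both a and b: it would be the
    -- conjugate of a simple term on the nonsimple edge {a, b}.
    no-spanning-term : ∀ {g} → g ∈ simplePart → Touches g a → Touches g b → ⊥
    no-spanning-term g∈ ga gb with origin-of [] r [] g∈
    ... | origin {Q} {s} Q-matched _ simple refl =
      let (fst∈ , snd∈) = ends-in-pair ga gb in
      simple (M-SameEdge ab (SameEdge-sym (pair-edge (relabel-pair⁻ Q Q-matched ab fst∈)
                                                      (relabel-pair⁻ Q Q-matched ab snd∈) (distinct s))))

    one-end-untouched : Untouched a ⊎ Untouched b
    one-end-untouched with touched? normal a | touched? normal b
    ... | no a-free | _ = inj₁ a-free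
    ... | yes _ | no b-free = inj₂ b-free
    ... | yes ta | yes tb =
      let (g₁ , g₁∈ , g₁a) = find ta
          (g₂ , g₂∈ , g₂b) = find tb
          g₁∈′ = touching-simple g₁∈ (touching g₁a (inj₁ refl))
          g₂∈′ = touching-simple g₂∈ (touching g₂b (inj₂ refl))
          g₁≡g₂ = count-≤1 (touchesPair? a b) simplePart simple-touching-≤1 g₁∈′ g₂∈′
                    (touching g₁a (inj₁ refl)) (touching g₂b (inj₂ refl))
      in ⊥-elim (no-spanning-term g₁∈′ g₁a (subst (λ g → Touches g b) (sym g₁≡g₂) g₂b))
      where
      touching : ∀ {g z} → Touches g z → InPair a b z → TouchesPair a b g
      touching (at-fst refl) z∈ = inj₁ z∈
      touching (at-snd refl) z∈ = inj₂ z∈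

    -- The conjugate of the simple term on {middle, other} touches the pair.
    not-both-untouched : ¬ (Untouched a × Untouched b)
    not-both-untouched (a-free , b-free) with find (mult-pos⇒Carries u middle-other)
    ... | (s , s∈ , on) with simple-survives s∈ (λ m → other-simple (M-SameEdge m (OnEdge⇒SameEdge on)))
    ...   | (Q , Q-matched , g∈) with relabel-pair Q Q-matched ab (fromTwig (inj₂ refl))
    ...     | inj₁ z≡a = a-free (lose g∈ (subst (Touches _) z≡a (conjugate-touches Q on)))
    ...     | inj₂ z≡b = b-free (lose g∈ (subst (Touches _) z≡b (conjugate-touches Q on)))

  -- Every untouched point is an end of an even multiedge: an odd
  -- nonsimple edge survives in the odd part, and at a point on no
  -- nonsimple edge the conjugate of any edge of u still touches it.
  untouched⇒even : Connected u → (∀ (z : Fin n) → ∃ λ y → y ≢ z) →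
                   ∀ {z} → Untouched z → ∃ λ w → EvenPos (mult u z w)
  untouched⇒even connected second {z} z-free with matched? z
  ... | inj₁ (w , ns) with mult u z w % 2 ℕₚ.≟ 0
  ...   | yes even = w , ℕₚ.≤-trans (s≤s z≤n) ns , even
  ...   | no odd = ⊥-elim (z-free (Carries⇒Touched (odd-present ns odd)))
  untouched⇒even connected second {z} z-free | inj₂ free
    with first-step (Walk⇒Reach (connected z (proj₁ (second z)))) (proj₂ (second z))
  ... | (w , c) with find c
  ...   | (s , s∈ , on) with simple-survives s∈ (λ m → free w (M-SameEdge m (OnEdge⇒SameEdge on)))
  ...     | (Q , Q-matched , g∈) =
    ⊥-elim (z-free (lose g∈ (subst (Touches _) (relabel-unmatched Q Q-matched free) (conjugate-touches Q on))))

  Extended : Fin n → Fin n → Set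
  Extended x y = Carries normal x y ⊎ NonSimple u x y

  Extended-sym : ∀ {x y} → Extended x y → Extended y x
  Extended-sym = Sum.map Carries-sym NonSimple-sym

  -- A simple edge of T(u) is replaced by its conjugate in the normal form,
  -- reached from its ends along nonsimple edges.
  u-step⇒extended : ∀ {x y} → Carries u x y → Star Extended x y
  u-step⇒extended {x} {y} c with nonSimple? x y
  ... | yes ns = inj₂ ns ◅ ε
  ... | no simple with find c
  ...   | (s , s∈ , on) with simple-survives s∈ (λ m → simple (M-SameEdge m (OnEdge⇒SameEdge on)))
  ...     | (Q , Q-matched , g∈) = across on
    where
    hop : ∀ z → Star Extended (relabel Q z) z
    hop z = Star.map inj₂ (relabel-hop Q z Q-matched)
    conjugate-edge : Star Extended (relabel Q (fst s)) (relabel Q (snd s))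
    conjugate-edge = inj₁ (lose g∈ (onEdge-refl _)) ◅ ε
    across : ∀ {x y} → OnEdge s x y → Star Extended x y
    across (forward refl refl) =
      Star.reverse Extended-sym (hop (fst s)) ◅◅ conjugate-edge ◅◅ hop (snd s)
    across (backward refl refl) =
      Star.reverse Extended-sym (hop (snd s)) ◅◅ Star.reverse Extended-sym conjugate-edge ◅◅ hop (fst s)

  extended-split : ∀ {x y} → Extended x y → Carries normal x y ⊎ Untouched x ⊎ Untouched y
  extended-split (inj₁ c) = inj₁ c
  extended-split {x} {y} (inj₂ ns) with mult u x y % 2 ℕₚ.≟ 0
  ... | yes even = inj₂ (EvenEdge.one-end-untouched (ℕₚ.≤-trans (s≤s z≤n) ns , even))
  ... | no odd = inj₁ (odd-present ns odd)

  untouched-dead-end : ∀ {z y₁ y₂} → Untouched z → Extended z y₁ → Extended z y₂ → y₁ ≡ y₂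
  untouched-dead-end z-free (inj₁ c) _ = ⊥-elim (z-free (Carries⇒Touched c))
  untouched-dead-end z-free (inj₂ _) (inj₁ c) = ⊥-elim (z-free (Carries⇒Touched c))
  untouched-dead-end {z} {y₁} {y₂} _ (inj₂ ns₁) (inj₂ ns₂) = one-nonsimple z y₁ y₂ ns₁ ns₂

  touched-connected : Connected u → ∀ {x y} → ¬ Untouched x → ¬ Untouched y → Reach normal x y
  touched-connected connected {x} {y} x-live y-live =
    DeadEnds.prune extended-split untouched-dead-end
      (λ c y-free → y-free (Carries⇒Touched (Carries-sym c))) Extended-sym
      x-live (Walk⇒Reach (connected x y) >>= u-step⇒extended) y-live

module _ {n : ℕ} where

  open import Data.List.Membership.DecPropositional (_≟_ {n}) using (_∈?_)

  trace-map : ∀ {f g : Fin n → Fin n} (h : Fin n → Fin n) → (∀ w → g (h w) ≡ h (f w)) →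
              ∀ {x ys z} → Trace f x ys z → Trace g (h x) (map h ys) (h z)
  trace-map h commute end = end
  trace-map h commute (next e p) = next (trans (commute _) (cong h e)) (trace-map h commute p)

  traces-same-end : ∀ {f g : Fin n → Fin n} {x x′ ys z z′ w} →
                    Trace f x ys z → Trace g x′ ys z′ → w ∈ ys → z ≡ z′
  traces-same-end (next _ end) (next _ end) _ = refl
  traces-same-end (next _ p@(next _ _)) (next _ q@(next _ _)) _ = traces-same-end p q (here refl)

  traces-agree : ∀ {f g : Fin n → Fin n} {x ys z} → Trace f x ys z → Trace g x ys z →
                 ∀ {w} → w ∈ ys → w ≡ z ⊎ f w ≡ g w
  traces-agree (next _ end) (next _ end) (here refl) = inj₁ refl
  traces-agree (next _ (next e p)) (next _ (next e′ q)) (here refl) = inj₂ (trans e (sym e′))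
  traces-agree (next _ p) (next _ q) (there w∈) = traces-agree p q w∈

  closed-traces-agree : ∀ {f g : Fin n → Fin n} {x ys} → Trace f x ys x → Trace g x ys x →
                        ∀ {w} → w ∈ ys → f w ≡ g w
  closed-traces-agree p@(next e _) q@(next e′ _) w∈ with traces-agree p q w∈
  ... | inj₁ refl = trans e (sym e′)
  ... | inj₂ agree = agree

  trace-iterates : ∀ (σ : Permutation′ n) {x ys z} → Trace (σ ⟨$⟩ʳ_) x ys z →
                   ∀ {w} → w ∈ ys → ∃[ i ] iter σ i x ≡ w
  trace-iterates σ (next e p) (here refl) = 1 , e
  trace-iterates σ (next e p) (there w∈) =
    let (i , σⁱy≡w) = trace-iterates σ p w∈ in suc i , trans (cong (iter σ i) e) σⁱy≡w

  permutation-injective : ∀ (τ : Permutation′ n) {a b} → τ ⟨$⟩ʳ a ≡ τ ⟨$⟩ʳ b → a ≡ b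
  permutation-injective τ e = trans (sym (inverseˡ τ)) (trans (cong (τ ⟨$⟩ˡ_) e) (inverseˡ τ))

  -- Duplicate-free lists of the same length are related by a permutation;
  -- by induction, composing with a transposition to fix the head.
  align : ∀ (c d : List (Fin n)) → Unique c → Unique d → length c ≡ length d →
          Σ (Permutation′ n) λ τ → map (τ ⟨$⟩ʳ_) c ≡ d
  align [] [] _ _ _ = id , refl
  align (a ∷ c) (b ∷ d) (a∉c ∷ uc) (b∉d ∷ ud) e with align c d uc ud (ℕₚ.suc-injective e)
  ... | (τ′ , τ′c≡d) = τ , cong₂ _∷_ (swap-fst (τ′ ⟨$⟩ʳ a) b) rest
    where
    τ = τ′ ∘ₚ transpose (τ′ ⟨$⟩ʳ a) b
    τ′a∉d : ∀ {z} → z ∈ d → z ≢ τ′ ⟨$⟩ʳ a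
    τ′a∉d {z} z∈ z≡ with ∈-map⁻ (τ′ ⟨$⟩ʳ_) (subst (z ∈_) (sym τ′c≡d) z∈)
    ... | (w , w∈ , refl) = All.lookup a∉c w∈ (sym (permutation-injective τ′ z≡))
    fixed : ∀ ds → (∀ {z} → z ∈ ds → z ∈ d) → map (swap (τ′ ⟨$⟩ʳ a) b) ds ≡ ds
    fixed [] _ = refl
    fixed (z ∷ ds) ⊆d =
      cong₂ _∷_ (swap-other (τ′a∉d (⊆d (here refl))) (λ z≡b → All.lookup b∉d (⊆d (here refl)) (sym z≡b)))
                                  (fixed ds (λ z∈ → ⊆d (there z∈)))
    rest : map (τ ⟨$⟩ʳ_) c ≡ d
    rest = trans (map-∘ c) (trans (cong (map (swap (τ′ ⟨$⟩ʳ a) b)) τ′c≡d) (fixed d (λ z∈ → z∈)))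

  record OneCycle (σ : Permutation′ n) (b : ℕ) : Set where
    field
      ys : List (Fin n)
      start : Fin n
      trace : Trace (σ ⟨$⟩ʳ_) start ys start
      unique : Unique ys
      start∈ : start ∈ ys
      fixes : ∀ {y} → y ∉ ys → σ ⟨$⟩ʳ y ≡ y
      size : length ys + b ≡ n

  -- Two such permutations with the same b are conjugate: a permutation
  -- τ carrying one cycle onto the other conjugates one into the other.
  one-cycle-conjugate : ∀ {σ ρ : Permutation′ n} {b} → OneCycle σ b → OneCycle ρ b → Conjugate σ ρ
  one-cycle-conjugate {σ} {ρ} {b} C D = τ , agree
    where
    module C = OneCycle C
    module D = OneCycle D
    aligned = align C.ys D.ys C.unique D.unique (ℕₚ.+-cancelʳ-≡ _ _ _ (trans C.size (sym D.size)))
    τ = proj₁ aligned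
    σ′ : Fin n → Fin n
    σ′ x = (flip τ ∘ₚ σ ∘ₚ τ) ⟨$⟩ʳ x
    σ′-τ : ∀ w → σ′ (τ ⟨$⟩ʳ w) ≡ τ ⟨$⟩ʳ (σ ⟨$⟩ʳ w)
    σ′-τ w = cong (λ v → τ ⟨$⟩ʳ (σ ⟨$⟩ʳ v)) (inverseˡ τ)
    moved-trace : Trace σ′ (τ ⟨$⟩ʳ C.start) D.ys (τ ⟨$⟩ʳ C.start)
    moved-trace = subst (λ l → Trace σ′ (τ ⟨$⟩ʳ C.start) l (τ ⟨$⟩ʳ C.start)) (proj₂ aligned)
                        (trace-map (τ ⟨$⟩ʳ_) σ′-τ C.trace)
    same-start : τ ⟨$⟩ʳ C.start ≡ D.start
    same-start = traces-same-end moved-trace D.trace D.start∈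
    agree : ∀ x → σ′ x ≡ ρ ⟨$⟩ʳ x
    agree x with x ∈? D.ys
    ... | yes x∈ = closed-traces-agree (subst (λ v → Trace σ′ v D.ys v) same-start moved-trace) D.trace x∈
    ... | no x∉ = trans (cong (τ ⟨$⟩ʳ_) (C.fixes τ⁻¹x∉)) (trans (inverseʳ τ) (sym (D.fixes x∉)))
      where
      τ⁻¹x∉ : (τ ⟨$⟩ˡ x) ∉ C.ys
      τ⁻¹x∉ w∈ = x∉ (subst (x ∈_) (proj₂ aligned)
                       (subst (_∈ map (τ ⟨$⟩ʳ_) C.ys) (inverseʳ τ) (∈-map⁺ (τ ⟨$⟩ʳ_) w∈)))

-- The unordered pairs {x, y} of points of n, listed once as (x , y) with
-- x < y; this is the list numEvenEdges of Defs runs through.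
module _ {n : ℕ} where

  pairIf : ∀ {P : Set} → Fin n → Fin n → Dec P → List (Fin n × Fin n)
  pairIf x y d = if does d then (x , y) ∷ [] else []

  orderedPair : Fin n → Fin n → List (Fin n × Fin n)
  orderedPair x y = pairIf x y (toℕ x <? toℕ y)

  pairs : List (Fin n × Fin n)
  pairs = concatMap (λ x → concatMap (λ y → orderedPair x y) (allFin n)) (allFin n)

  pairIf⁻ : ∀ {P : Set} x y (d : Dec P) {p} → p ∈ pairIf x y d → p ≡ (x , y) × P
  pairIf⁻ x y (yes q) (here refl) = refl , q

  pairIf⁺ : ∀ {P : Set} x y (d : Dec P) → P → (x , y) ∈ pairIf x y d
  pairIf⁺ x y (yes _) _ = here refl
  pairIf⁺ x y (no ¬q) q = ⊥-elim (¬q q)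

  pairIf-unique : ∀ {P : Set} x y (d : Dec P) → Unique (pairIf x y d)
  pairIf-unique x y (yes _) = All.[] AllPairs.∷ AllPairs.[]
  pairIf-unique x y (no _) = AllPairs.[]

  orderedPair⁻ : ∀ x y {p} → p ∈ orderedPair x y → p ≡ (x , y) × toℕ x < toℕ y
  orderedPair⁻ x y = pairIf⁻ x y (toℕ x <? toℕ y)

  pairs⁻ : ∀ {p} → p ∈ pairs → toℕ (proj₁ p) < toℕ (proj₂ p)
  pairs⁻ p∈ with find (∈-concatMap⁻ _ {xs = allFin n} p∈)
  ... | (x , _ , p∈x) with find (∈-concatMap⁻ _ {xs = allFin n} p∈x)
  ...   | (y , _ , p∈xy) with orderedPair⁻ x y p∈xy
  ...     | (refl , x<y) = x<y

  pairs⁺ : ∀ x y → toℕ x < toℕ y → (x , y) ∈ pairs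
  pairs⁺ x y x<y =
    ∈-concatMap⁺ _ (Any.map (λ { refl →
      ∈-concatMap⁺ _ (Any.map (λ { refl → pairIf⁺ x y (toℕ x <? toℕ y) x<y })
        (∈-allFin y)) }) (∈-allFin x))

  pairs-unique : Unique pairs
  pairs-unique =
    concatMap-unique _ (allFin n) (Unique.allFin⁺ n)
      (λ x → concatMap-unique (orderedPair x) (allFin n) (Unique.allFin⁺ n) (λ y → pairIf-unique x y (toℕ x <? toℕ y)) proj₂
               (λ {y} z∈ → cong proj₂ (proj₁ (orderedPair⁻ x y z∈))))
      proj₁
      (λ {x} z∈ → let (y , _ , z∈xy) = find (∈-concatMap⁻ (orderedPair x) {xs = allFin n} z∈) in
                  cong proj₁ (proj₁ (orderedPair⁻ x y z∈xy)))

evenPos? : ∀ k → Dec (EvenPos k)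
evenPos? k = (0 <? k) ×-dec (k % 2 ℕₚ.≟ 0)

-- The untouched points of the normal form are counted by the even
-- multiedges: each even multiedge has exactly one untouched end, and
-- distinct even multiedges are disjoint by hypothesis (1).
module Counting {n : ℕ} (u : List (Transp n))
    (one-nonsimple : ∀ (v w w′ : Fin n) → NonSimple u v w → NonSimple u v w′ → w ≡ w′)
    (even-twig : ∀ (x y : Fin n) → EvenPos (mult u x y) →
       (Multitwig u x y × ExactlyTwoNeighbors u y) ⊎ (Multitwig u y x × ExactlyTwoNeighbors u x))
    (connected : Connected u) (second : ∀ (z : Fin n) → ∃ λ y → y ≢ z)
    (r : List (Transp n)) (r↭u : r ↭ u) where

  open Analysis u one-nonsimple even-twig r r↭u

  evenPair? : (p : Fin n × Fin n) → Dec (EvenPos (mult u (proj₁ p) (proj₂ p)))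
  evenPair? p = evenPos? (mult u (proj₁ p) (proj₂ p))

  evenPairs : List (Fin n × Fin n)
  evenPairs = filter evenPair? pairs

  evenPairs⁻ : ∀ {p} → p ∈ evenPairs → toℕ (proj₁ p) < toℕ (proj₂ p) × EvenPos (mult u (proj₁ p) (proj₂ p))
  evenPairs⁻ p∈ = let (p∈pairs , ep) = ∈-filter⁻ evenPair? p∈ in pairs⁻ p∈pairs , ep

  chooseUntouched : (a b : Fin n) → Dec (Touched normal a) → Fin n
  chooseUntouched a b (yes _) = b
  chooseUntouched a b (no _) = a

  untouchedEnd : Fin n × Fin n → Fin n
  untouchedEnd (a , b) = chooseUntouched a b (touched? normal a)

  chooseUntouched-end : ∀ a b d → chooseUntouched a b d ≡ a ⊎ chooseUntouched a b d ≡ b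
  chooseUntouched-end a b (yes _) = inj₂ refl
  chooseUntouched-end a b (no _) = inj₁ refl

  chooseUntouched-untouched : ∀ a b d → Untouched a ⊎ Untouched b → Untouched (chooseUntouched a b d)
  chooseUntouched-untouched a b (yes ta) (inj₁ a-free) = ⊥-elim (a-free ta)
  chooseUntouched-untouched a b (yes _) (inj₂ b-free) = b-free
  chooseUntouched-untouched a b (no a-free) _ = a-free

  share⇒same : ∀ {a b a′ b′ d} → NonSimple u a b → NonSimple u a′ b′ →
               (d ≡ a ⊎ d ≡ b) → (d ≡ a′ ⊎ d ≡ b′) → SameEdge a b a′ b′
  share⇒same {a} {b} {a′} {b′} ab a′b′ (inj₁ refl) (inj₁ refl) = inj₁ (refl , one-nonsimple a b b′ ab a′b′)
  share⇒same {a} {b} {a′} {b′} ab a′b′ (inj₁ refl) (inj₂ refl) = inj₂ (refl , one-nonsimple a b a′ ab (NonSimple-sym a′b′))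
  share⇒same {a} {b} {a′} {b′} ab a′b′ (inj₂ refl) (inj₁ refl) = inj₂ (one-nonsimple b a b′ (NonSimple-sym ab) a′b′ , refl)
  share⇒same {a} {b} {a′} {b′} ab a′b′ (inj₂ refl) (inj₂ refl) =
    inj₁ (one-nonsimple b a a′ (NonSimple-sym ab) (NonSimple-sym a′b′) , refl)

  ordered-same : ∀ {a b a′ b′ : Fin n} → toℕ a < toℕ b → toℕ a′ < toℕ b′ →
                 SameEdge a b a′ b′ → (a , b) ≡ (a′ , b′)
  ordered-same _ _ (inj₁ (refl , refl)) = refl
  ordered-same a<b a′<b′ (inj₂ (refl , refl)) = ⊥-elim (ℕₚ.<-asym a<b a′<b′)

  -- Distinct even multiedges have distinct untouched ends, being disjoint.
  untouchedEnds-unique : Unique (map untouchedEnd evenPairs)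
  untouchedEnds-unique = map-unique untouchedEnd evenPairs (Unique.filter⁺ evenPair? pairs-unique) injective
    where
    injective : ∀ {p q} → p ∈ evenPairs → q ∈ evenPairs → untouchedEnd p ≡ untouchedEnd q → p ≡ q
    injective {a , b} {a′ , b′} p∈ q∈ e =
      let (a<b , ep) = evenPairs⁻ p∈
          (a′<b′ , ep′) = evenPairs⁻ q∈
      in ordered-same a<b a′<b′ (share⇒same (EvenPos⇒2≤ ep) (EvenPos⇒2≤ ep′)
           (chooseUntouched-end a b _)
           (subst (λ v → v ≡ a′ ⊎ v ≡ b′) (sym e) (chooseUntouched-end a′ b′ _)))

  untouchedEnd-untouched : ∀ {p} → p ∈ evenPairs → Untouched (untouchedEnd p)
  untouchedEnd-untouched {a , b} p∈ =
    chooseUntouched-untouched a b _ (EvenEdge.one-end-untouched (proj₂ (evenPairs⁻ p∈)))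

  untouched⇒untouchedEnd : ∀ {z} → Untouched z → z ∈ map untouchedEnd evenPairs
  untouched⇒untouchedEnd {z} z-free with untouched⇒even connected second z-free
  ... | (w , ep) with ℕₚ.<-cmp (toℕ z) (toℕ w)
  ...   | tri< z<w _ _ = subst (_∈ map untouchedEnd evenPairs) (chosen (touched? normal z))
                           (∈-map⁺ untouchedEnd (∈-filter⁺ evenPair? (pairs⁺ z w z<w) ep))
    where
    chosen : ∀ d → chooseUntouched z w d ≡ z
    chosen (yes tz) = ⊥-elim (z-free tz)
    chosen (no _) = refl
  ...   | tri≈ _ z≡w _ = ⊥-elim (ℕₚ.<⇒≱ (EvenPos⇒2≤ ep)
                            (subst (λ v → mult u z v ≤ 1) (toℕ-injective z≡w)
                              (ℕₚ.≤-trans (ℕₚ.≤-reflexive (mult-irreflexive u z)) z≤n)))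
  ...   | tri> _ _ w<z = subst (_∈ map untouchedEnd evenPairs) (chosen (touched? normal w))
                           (∈-map⁺ untouchedEnd (∈-filter⁺ evenPair? (pairs⁺ w z w<z) (subst EvenPos (mult-sym u z w) ep)))
    where
    chosen : ∀ d → chooseUntouched w z d ≡ z
    chosen (yes _) = refl
    chosen (no w-free) = ⊥-elim (EvenEdge.not-both-untouched ep (z-free , w-free))

  untouched? : ∀ z → Dec (Untouched z)
  untouched? z = ¬? (touched? normal z)

  untouched-count : count untouched? (allFin n) ≡ numEvenEdges u
  untouched-count = trans
    (same-elements⇒same-length (Unique.filter⁺ untouched? {xs = allFin n} (Unique.allFin⁺ n)) untouchedEnds-unique
      (λ z∈ → untouched⇒untouchedEnd (proj₂ (∈-filter⁻ untouched? {xs = allFin n} z∈)))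
      (λ z∈ → let (p , p∈ , z≡) = ∈-map⁻ untouchedEnd z∈ in
              ∈-filter⁺ untouched? (∈-allFin _) (subst Untouched (sym z≡) (untouchedEnd-untouched p∈))))
    (length-map untouchedEnd evenPairs)

module Product {n : ℕ} (u : List (Transp n))
    (one-nonsimple : ∀ (v w w′ : Fin n) → NonSimple u v w → NonSimple u v w′ → w ≡ w′)
    (even-twig : ∀ (x y : Fin n) → EvenPos (mult u x y) →
       (Multitwig u x y × ExactlyTwoNeighbors u y) ⊎ (Multitwig u y x × ExactlyTwoNeighbors u x))
    (acyclic : Acyclic u) (connected : Connected u)
    (z₀ : Fin n) (second : ∀ (z : Fin n) → ∃ λ y → y ≢ z)
    (r : List (Transp n)) (r↭u : r ↭ u) where

  open Analysis u one-nonsimple even-twig r r↭u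
  open Counting u one-nonsimple even-twig connected second r r↭u

  σ : Fin n → Fin n
  σ = applyWord normal

  cycles : ∀ x → CycleOn σ normal x
  cycles = separated⇒cycles normal (normal-separated acyclic)

  untouched-fixed : ∀ {z} → Untouched z → σ z ≡ z
  untouched-fixed = applyWord-untouched normal

  touched-moved : ∀ {z} → ¬ Untouched z → σ z ≢ z
  touched-moved {z} z-live with touched? normal z
  ... | no z-free = ⊥-elim (z-live z-free)
  ... | yes tz = let (w , c , w≢z) = touched-neighbour tz in cycle-moves (cycles z) (c ◅ ε) w≢z

  -- Some point is touched: if z₀ is not, it is the untouched end of an
  -- even multiedge whose other end is touched.
  touched-point : ∃ λ x → ¬ Untouched x
  touched-point with touched? normal z₀
  ... | yes t = z₀ , λ z₀-free → z₀-free t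
  ... | no z₀-free = let (w , ep) = untouched⇒even connected second z₀-free in
                     w , λ w-free → EvenEdge.not-both-untouched ep (z₀-free , w-free)

  x₀ : Fin n
  x₀ = proj₁ touched-point

  open CycleOn (cycles x₀)

  ys-touched : ∀ {y} → y ∈ ys → ¬ Untouched y
  ys-touched y∈ y-free = proj₂ touched-point (isolated y-free (Reach-sym (sound y∈)))
    where
    isolated : ∀ {z y} → Untouched z → Reach normal z y → Untouched y
    isolated z-free ε = z-free
    isolated z-free (c ◅ _) = ⊥-elim (z-free (Carries⇒Touched c))

  touched-ys : ∀ {y} → ¬ Untouched y → y ∈ ys
  touched-ys y-live = complete (touched-connected connected (proj₂ touched-point) y-live)

  cycle-size : length ys + numEvenEdges u ≡ n
  cycle-size = begin
    length ys + numEvenEdges u                                     ≡⟨ cong₂ _+_ touched-count (sym untouched-count) ⟩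
    count (touched? normal) (allFin n) + count untouched? (allFin n) ≡⟨ count-complement (touched? normal) (allFin n) ⟩
    length (allFin n)                                              ≡⟨ length-tabulate (λ i → i) ⟩
    n                                                              ∎
    where
    open ≡-Reasoning
    touched-count : length ys ≡ count (touched? normal) (allFin n)
    touched-count = same-elements⇒same-length unique (Unique.filter⁺ (touched? normal) {xs = allFin n} (Unique.allFin⁺ n))
      (λ y∈ → ∈-filter⁺ (touched? normal) (∈-allFin _) (decidable-stable (touched? normal _) (ys-touched y∈)))
      (λ y∈ → touched-ys (λ y-free → y-free (proj₂ (∈-filter⁻ (touched? normal) {xs = allFin n} y∈))))

  module _ (ρ : Permutation′ n) (ρ≗○r : ∀ x → ρ ⟨$⟩ʳ x ≡ ○ r ⟨$⟩ʳ x) where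

    ρ≗σ : ∀ x → ρ ⟨$⟩ʳ x ≡ σ x
    ρ≗σ x = trans (ρ≗○r x) (trans (○-applyWord r x) (applyWord-normal x))

    fixed⇔untouched : ∀ x → (ρ ⟨$⟩ʳ x ≡ x → Untouched x) × (Untouched x → ρ ⟨$⟩ʳ x ≡ x)
    fixed⇔untouched x = (λ e x-live → touched-moved (λ x-free → x-free x-live) (trans (sym (ρ≗σ x)) e))
                      , (λ x-free → trans (ρ≗σ x) (untouched-fixed x-free))

    one-cycle : OneCycle ρ (numEvenEdges u)
    one-cycle = record
      { ys = ys ; start = x₀
      ; trace = trace-cong ρ≗σ trace
      ; unique = unique
      ; start∈ = touched-ys (proj₂ touched-point)
      ; fixes = λ {y} y∉ → trans (ρ≗σ y) (untouched-fixed (λ y-live → y∉ (touched-ys (λ y-free → y-free y-live))))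
      ; size = cycle-size }

    in-class : InClass1b (numEvenEdges u) ρ
    in-class =
      trans (count-cong (λ x → ρ ⟨$⟩ʳ x ≟ x) untouched? (allFin n) fixed⇔untouched) untouched-count ,
      x₀ , (λ e → touched-moved (proj₂ touched-point) (trans (sym (ρ≗σ x₀)) e)) ,
      λ y moved → trace-iterates ρ (OneCycle.trace one-cycle)
                    (touched-ys (λ y-free → moved (proj₂ (fixed⇔untouched y) y-free)))

theorem3p6 : (n : ℕ) → 4 ≤ n → (u : List (Transp n)) → 3 ≤ length u →
    Multitree u →
    (∀ (v w w′ : Fin n) → NonSimple u v w → NonSimple u v w′ → w ≡ w′) →
    (∀ (x y : Fin n) → EvenPos (mult u x y) →
      (Multitwig u x y × ExactlyTwoNeighbors u y) ⊎ (Multitwig u y x × ExactlyTwoNeighbors u x)) →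
    (∀ (σ : Permutation′ n) → σ ∈Prod u → InClass1b (numEvenEdges u) σ) × ConjugacyInvariant u
theorem3p6 (suc (suc m)) (s≤s (s≤s _)) u _ (connected , acyclic) one-nonsimple even-twig =
  (λ { ρ (r , r↭u , ρ≗○r) → Prod.in-class r r↭u ρ ρ≗○r }) ,
  (λ { ρ (r , r↭u , ρ≗○r) → one-cycle-conjugate (Prod.one-cycle r r↭u ρ ρ≗○r)
                                                 (Prod.one-cycle u ↭-refl (○ u) (λ _ → refl)) })
  where
  second : ∀ (z : Fin (suc (suc m))) → ∃ λ y → y ≢ z
  second F.zero = F.suc F.zero , λ ()
  second (F.suc z) = F.zero , λ ()

  module Prod = Product u one-nonsimple even-twig acyclic connected F.zero second
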